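{- Let $A\in 2^\omega$, let $d$ be a martingale with some code truth-table reducible to $A$, and let $f\colon\mathbb{N}\to\mathbb{N}$ be truth-table reducible to $A$. Then there is a uniform martingale test $\langle\hat d^X\rangle_{X\in 2^\omega}$ and a total computable functional $\Psi\colon 2^\omega\to\mathbb{N}^\mathbb{N}$, writing $\hat f^X=\Psi(X)$, such that $\hat d^A=d$ and $\hat f^A=f$.
   Context: A martingale is $d\colon 2^{<\omega}\to[0,\infty)$ with $d(\sigma0)+d(\sigma1)=2d(\sigma)$ for all $\sigma$. A code for a martingale is an element of $\mathbb{N}^\mathbb{N}$ giving, for each $\sigma$, a fast-Cauchy sequence of rationals converging to $d(\sigma)$ (fast-Cauchy: $|q_k-q_m|\le 2^{ -m}$ for $k\ge m$). An element $g\in\mathbb{N}^\mathbb{N}$ is truth-table reducible to $A$ if there is a total computable functional $\Phi\colon 2^\omega\to\mathbb{N}^\mathbb{N}$ with $g=\Phi(A)$. A uniform martingale test is a total computable map $\Phi\colon 2^\omega\to\mathbb{N}^\mathbb{N}$ such that each $\Phi(X)$ encodes a martingale $\hat d^X$. -}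

module Defs where

open import Data.Nat as ℕ using (ℕ; zero; suc; _<_; _≤_)
open import Data.Fin using (Fin)
open import Data.Vec using (Vec; []; _∷_; lookup)
open import Data.Bool using (Bool; true; false)
open import Data.List using (List; []; _∷_; _∷ʳ_)
open import Data.Product using (Σ; ∃; _×_; _,_)
open import Data.Integer as ℤ using (ℤ; +_)
open import Data.Rational.Unnormalised as ℚ using (ℚᵘ; mkℚᵘ)
open import Relation.Binary.PropositionalEquality using (_≡_)

Cantor : Set
Cantor = ℕ → Bool

Baire : Set
Baire = ℕ → ℕ

Str : Set
Str = List Bool

data Code : ℕ → Set where
  zeroC  : ∀ {n} → Code n
  succC  : Code 1
  projC  : ∀ {n} → Fin n → Code n
  compC  : ∀ {m n} → Code m → Vec (Code n) m → Code n
  precC  : ∀ {n} → Code n → Code (suc (suc n)) → Code (suc n)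
  muC    : ∀ {n} → Code (suc n) → Code n
  oracleC : Code 1

bit : Bool → ℕ
bit false = 0
bit true  = 1

mutual
  data Eval (X : Cantor) : ∀ {n} → Code n → Vec ℕ n → ℕ → Set where
    ev-zero : ∀ {n} {xs : Vec ℕ n} → Eval X zeroC xs 0
    ev-succ : ∀ {x} → Eval X succC (x ∷ []) (suc x)
    ev-proj : ∀ {n} {i : Fin n} {xs} → Eval X (projC i) xs (lookup xs i)
    ev-comp : ∀ {m n} {f : Code m} {gs : Vec (Code n) m} {xs ys y} →
              EvalVec X gs xs ys → Eval X f ys y → Eval X (compC f gs) xs y
    ev-prec-zero : ∀ {n} {f : Code n} {g} {xs y} →
              Eval X f xs y → Eval X (precC f g) (0 ∷ xs) y
    ev-prec-suc : ∀ {n} {f : Code n} {g} {xs k r y} →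
              Eval X (precC f g) (k ∷ xs) r →
              Eval X g (k ∷ r ∷ xs) y →
              Eval X (precC f g) (suc k ∷ xs) y
    ev-mu   : ∀ {n} {f : Code (suc n)} {xs k} →
              Eval X f (k ∷ xs) 0 →
              (∀ j → j < k → Σ ℕ λ r → Eval X f (j ∷ xs) (suc r)) →
              Eval X (muC f) xs k
    ev-oracle : ∀ {x} → Eval X oracleC (x ∷ []) (bit (X x))

  data EvalVec (X : Cantor) {n : ℕ} : ∀ {m} → Vec (Code n) m → Vec ℕ n → Vec ℕ m → Set where
    []  : ∀ {xs} → EvalVec X [] xs []
    _∷_ : ∀ {m} {g} {gs : Vec (Code n) m} {xs y ys} →
          Eval X g xs y → EvalVec X gs xs ys → EvalVec X (g ∷ gs) xs (y ∷ ys)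

TotalComputable : (Cantor → Baire) → Set
TotalComputable Φ = Σ (Code 1) λ e → ∀ (X : Cantor) (n : ℕ) → Eval X e (n ∷ []) (Φ X n)

TTReducible : Baire → Cantor → Set
TTReducible g A = Σ (Cantor → Baire) λ Φ → TotalComputable Φ × (∀ n → Φ A n ≡ g n)

tri : ℕ → ℕ
tri zero    = zero
tri (suc n) = suc n ℕ.+ tri n

pair : ℕ → ℕ → ℕ
pair a b = tri (a ℕ.+ b) ℕ.+ b

-- inverse of pair (enumeration of ℕ×ℕ along diagonals)
unpair : ℕ → ℕ × ℕ
unpair zero = 0 , 0
unpair (suc n) with unpair n
... | a , zero  = 0 , suc a
... | a , suc b = suc a , b

-- bijective binary coding of strings
encStr : Str → ℕ
encStr []          = 0
encStr (false ∷ σ) = 1 ℕ.+ 2 ℕ.* encStr σ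
encStr (true ∷ σ)  = 2 ℕ.+ 2 ℕ.* encStr σ

-- decoding naturals as rationals (surjective): n = ⟨⟨a,b⟩,m⟩ ↦ (a - b)/(m+1)
decodeℚ : ℕ → ℚᵘ
decodeℚ n with unpair n
... | p , m with unpair p
...   | a , b = mkℚᵘ ((+ a) ℤ.- (+ b)) m

-- 2^{-k}
ε : ℕ → ℚᵘ
ε k = mkℚᵘ (+ 1) (2 ℕ.^ k ℕ.∸ 1)

-- the k-th rational approximation to d(σ) given by the code g ∈ ℕ^ℕ
approx : Baire → Str → ℕ → ℚᵘ
approx g σ k = decodeℚ (g (pair (encStr σ) k))

FastCauchyCode : Baire → Set
FastCauchyCode g = ∀ σ m k → m ≤ k →
  ℚ.∣ approx g σ k ℚ.- approx g σ m ∣ ℚ.≤ ε m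

-- g codes a martingale d : 2^{<ω} → [0,∞):
--   d(σ) ≥ 0           ⇔ ∀k. d_k(σ) ≥ -2^{-k}
--   d(σ0)+d(σ1)=2d(σ)  ⇔ ∀k. |d_k(σ0)+d_k(σ1)-2d_k(σ)| ≤ 4·2^{-k}
IsMartingaleCode : Baire → Set
IsMartingaleCode g =
  FastCauchyCode g ×
  (∀ σ k → ℚ.- ε k ℚ.≤ approx g σ k) ×
  (∀ σ k → ℚ.∣ (approx g (σ ∷ʳ false) k ℚ.+ approx g (σ ∷ʳ true) k)
               ℚ.- (ℚ.1ℚᵘ ℚ.+ ℚ.1ℚᵘ) ℚ.* approx g σ k ∣
             ℚ.≤ mkℚᵘ (+ 4) 0 ℚ.* ε k)

-- two (fast-Cauchy) codes code the same martingale: for all σ the reals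
-- coincide  ⇔ ∀k. |x_k - y_k| ≤ 2·2^{-k}
SameMartingale : Baire → Baire → Set
SameMartingale g h = ∀ σ k →
  ℚ.∣ approx g σ k ℚ.- approx h σ k ∣ ℚ.≤ mkℚᵘ (+ 2) 0 ℚ.* ε k

UniformMartingaleTest : (Cantor → Baire) → Set
UniformMartingaleTest Φ = TotalComputable Φ × (∀ X → IsMartingaleCode (Φ X))

module Submission where

-- Take Ψ = Φ_f.  For the test, apply a uniform repair procedure to the
-- would-be code h = Φ_g(X) of every oracle X:
--   * the approximations h proposes at each string are made fast-Cauchy, by falling back to
--     the last stage up to which the fast-Cauchy condition holds (module CauchyRepair);
--   * a martingale is built from the root along each string: the value at σ0 is h's
--     approximation clamped into [0, 2·value(σ)], and σ1 gets the rest (module Analysis).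
-- Evaluated at precision k + 3|σ| + 5, the values form the k-th approximation at σ of a code
-- which is fast-Cauchy, nonnegative and exactly martingale-like up to the allowed error, for
-- every h.  If h codes a martingale, its approximations are already fast-Cauchy and clamping
-- moves a value only by the errors of h, so the new code codes the same martingale.

open import Defs
open import Data.Nat using (ℕ)
open import Data.Product using (Σ; _×_)
open import Relation.Binary.PropositionalEquality using (_≡_)

module Computability where

  open import Defs
  open import Data.Nat using (ℕ; zero; suc)
  open import Data.Fin using (Fin) renaming (zero to fz; suc to fs)
  open import Data.Vec using (Vec; []; _∷_; lookup)
  open import Data.Product using (Σ; _,_)
  open import Relation.Binary.PropositionalEquality using (_≡_; subst)

  Functional : ℕ → Set
  Functional n = Cantor → Vec ℕ n → ℕ

  Computable : ∀ n → Functional n → Set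
  Computable n F = Σ (Code n) λ c → ∀ X xs → Eval X c xs (F X xs)

  ComputableVec : ∀ n m → (Cantor → Vec ℕ n → Vec ℕ m) → Set
  ComputableVec n m G = Σ (Vec (Code n) m) λ cs → ∀ X xs → EvalVec X cs xs (G X xs)

  computable⇒total : ∀ {Φ : Cantor → Baire} → Computable 1 (λ X xs → Φ X (lookup xs fz)) → TotalComputable Φ
  computable⇒total (c , ev) = c , λ X n → ev X (n ∷ [])

  total⇒computable : ∀ {Φ : Cantor → Baire} → TotalComputable Φ → Computable 1 (λ X xs → Φ X (lookup xs fz))
  total⇒computable (c , ev) = c , λ { X (n ∷ []) → ev X n }

  module _ {n : ℕ} where

    []ᶜ : ComputableVec n 0 (λ _ _ → [])
    []ᶜ = [] , λ X xs → []

    infixr 5 _∷ᶜ_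
    _∷ᶜ_ : ∀ {m F G} → Computable n F → ComputableVec n m G →
           ComputableVec n (suc m) (λ X xs → F X xs ∷ G X xs)
    (f , pf) ∷ᶜ (gs , pg) = (f ∷ gs) , λ X xs → pf X xs ∷ pg X xs

    computable-resp : ∀ {F G} → (∀ X xs → F X xs ≡ G X xs) → Computable n F → Computable n G
    computable-resp e (c , p) = c , λ X xs → subst (Eval X c xs) (e X xs) (p X xs)

    proj : (i : Fin n) → Computable n (λ _ xs → lookup xs i)
    proj i = projC i , λ X xs → ev-proj

    zeroᶜ : Computable n (λ _ _ → 0)
    zeroᶜ = zeroC , λ X xs → ev-zero

  compose : ∀ {n m F G} → Computable m F → ComputableVec n m G → Computable n (λ X xs → F X (G X xs))
  compose {G = G} (f , pf) (gs , pg) = compC f gs , λ X xs → ev-comp (pg X xs) (pf X (G X xs))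

  primRec : ∀ {n} → Functional n → Functional (suc (suc n)) → Functional (suc n)
  primRec F G X (zero ∷ xs) = F X xs
  primRec F G X (suc k ∷ xs) = G X (k ∷ primRec F G X (k ∷ xs) ∷ xs)

  primRecᶜ : ∀ {n F G} → Computable n F → Computable (suc (suc n)) G → Computable (suc n) (primRec F G)
  primRecᶜ {n} {F} {G} (f , pf) (g , pg) = precC f g , eval
    where
    eval : ∀ X xs → Eval X (precC f g) xs (primRec F G X xs)
    eval X (zero ∷ xs) = ev-prec-zero (pf X xs)
    eval X (suc k ∷ xs) = ev-prec-suc (eval X (k ∷ xs)) (pg X _)

  apply₁ : ∀ {n F G} → Computable 1 F → Computable n G → Computable n (λ X xs → F X (G X xs ∷ []))
  apply₁ f g = compose f (g ∷ᶜ []ᶜ)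

  apply₂ : ∀ {n F G₁ G₂} → Computable 2 F → Computable n G₁ → Computable n G₂ →
           Computable n (λ X xs → F X (G₁ X xs ∷ G₂ X xs ∷ []))
  apply₂ f g₁ g₂ = compose f (g₁ ∷ᶜ g₂ ∷ᶜ []ᶜ)

  apply₃ : ∀ {n F G₁ G₂ G₃} → Computable 3 F → Computable n G₁ → Computable n G₂ → Computable n G₃ →
           Computable n (λ X xs → F X (G₁ X xs ∷ G₂ X xs ∷ G₃ X xs ∷ []))
  apply₃ f g₁ g₂ g₃ = compose f (g₁ ∷ᶜ g₂ ∷ᶜ g₃ ∷ᶜ []ᶜ)

  apply₄ : ∀ {n F G₁ G₂ G₃ G₄} → Computable 4 F → Computable n G₁ → Computable n G₂ →
           Computable n G₃ → Computable n G₄ →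
           Computable n (λ X xs → F X (G₁ X xs ∷ G₂ X xs ∷ G₃ X xs ∷ G₄ X xs ∷ []))
  apply₄ f g₁ g₂ g₃ g₄ = compose f (g₁ ∷ᶜ g₂ ∷ᶜ g₃ ∷ᶜ g₄ ∷ᶜ []ᶜ)

  -- Computable oracle-free number functions; records so that the function is inferable.
  record Computable₁ (f : ℕ → ℕ) : Set where
    constructor computable₁
    field code₁ : Computable 1 (λ _ xs → f (lookup xs fz))

  record Computable₂ (f : ℕ → ℕ → ℕ) : Set where
    constructor computable₂
    field code₂ : Computable 2 (λ _ xs → f (lookup xs fz) (lookup xs (fs fz)))

  record Computable₃ (f : ℕ → ℕ → ℕ → ℕ) : Set where
    constructor computable₃
    field code₃ : Computable 3 (λ _ xs → f (lookup xs fz) (lookup xs (fs fz)) (lookup xs (fs (fs fz))))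

  open Computable₁ public
  open Computable₂ public
  open Computable₃ public

  call₁ : ∀ {n f G} → Computable₁ f → Computable n G → Computable n (λ X xs → f (G X xs))
  call₁ r = apply₁ (code₁ r)

  call₂ : ∀ {n f G₁ G₂} → Computable₂ f → Computable n G₁ → Computable n G₂ →
          Computable n (λ X xs → f (G₁ X xs) (G₂ X xs))
  call₂ r = apply₂ (code₂ r)

  call₃ : ∀ {n f G₁ G₂ G₃} → Computable₃ f → Computable n G₁ → Computable n G₂ → Computable n G₃ →
          Computable n (λ X xs → f (G₁ X xs) (G₂ X xs) (G₃ X xs))
  call₃ r = apply₃ (code₃ r)

  #0 : ∀ {n} → Computable (suc n) (λ _ xs → lookup xs fz)
  #0 = proj fz

  #1 : ∀ {n} → Computable (suc (suc n)) (λ _ xs → lookup xs (fs fz))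
  #1 = proj (fs fz)

  #2 : ∀ {n} → Computable (suc (suc (suc n))) (λ _ xs → lookup xs (fs (fs fz)))
  #2 = proj (fs (fs fz))

  #3 : ∀ {n} → Computable (suc (suc (suc (suc n)))) (λ _ xs → lookup xs (fs (fs (fs fz))))
  #3 = proj (fs (fs (fs fz)))

  sucᶜ : Computable₁ suc
  sucᶜ = computable₁ (succC , λ { X (x ∷ []) → ev-succ })

  constᶜ : ∀ {n} k → Computable n (λ _ _ → k)
  constᶜ zero = zeroᶜ
  constᶜ (suc k) = call₁ sucᶜ (constᶜ k)

module Arithmetic where

  open import Defs
  open Computability
  open import Data.Nat using (ℕ; zero; suc; _+_; _*_; _∸_; _^_; _≤_; _<_; z≤n; s≤s; _≤?_; pred)
  open import Data.Nat.Properties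
  open import Data.Fin using () renaming (zero to fz; suc to fs)
  open import Data.Vec using ([]; _∷_; lookup)
  open import Data.Product using (_×_; _,_; proj₁; proj₂)
  open import Data.Sum using (inj₁; inj₂)
  open import Data.Empty using (⊥-elim)
  open import Relation.Nullary using (¬_; yes; no)
  open import Relation.Binary using (tri<; tri≈; tri>)
  open import Relation.Binary.PropositionalEquality

  predᶜ : Computable₁ pred
  predᶜ = computable₁ (computable-resp (λ { X (zero ∷ []) → refl ; X (suc n ∷ []) → refl }) (primRecᶜ zeroᶜ #0))

  +ᶜ : Computable₂ _+_
  +ᶜ = computable₂ (computable-resp (λ { X (x ∷ y ∷ []) → unfold X x y }) (primRecᶜ #0 (call₁ sucᶜ #1)))
    where
    unfold : ∀ X x y → primRec (λ _ xs → lookup xs fz) (λ _ xs → suc (lookup xs (fs fz))) X (x ∷ y ∷ []) ≡ x + y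
    unfold X zero y = refl
    unfold X (suc x) y = cong suc (unfold X x y)

  ∸ᶜ : Computable₂ _∸_
  ∸ᶜ = computable₂ (computable-resp (λ { X (x ∷ y ∷ []) → unfold X y x }) (apply₂ (primRecᶜ #0 (call₁ predᶜ #1)) #1 #0))
    where
    unfold : ∀ X y x → primRec (λ _ xs → lookup xs fz) (λ _ xs → pred (lookup xs (fs fz))) X (y ∷ x ∷ []) ≡ x ∸ y
    unfold X zero x = refl
    unfold X (suc y) x = trans (cong pred (unfold X y x)) (pred[m∸n]≡m∸[1+n] x y)

  *ᶜ : Computable₂ _*_
  *ᶜ = computable₂ (computable-resp (λ { X (x ∷ y ∷ []) → unfold X x y }) (primRecᶜ zeroᶜ (call₂ +ᶜ #2 #1)))
    where
    unfold : ∀ X x y → primRec (λ _ _ → 0) (λ _ xs → lookup xs (fs (fs fz)) + lookup xs (fs fz)) X (x ∷ y ∷ []) ≡ x * y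
    unfold X zero y = refl
    unfold X (suc x) y = cong (y +_) (unfold X x y)

  pow2ᶜ : Computable₁ (2 ^_)
  pow2ᶜ = computable₁ (computable-resp (λ { X (x ∷ []) → unfold X x }) (primRecᶜ (constᶜ 1) (call₂ +ᶜ #1 #1)))
    where
    unfold : ∀ X x → primRec (λ _ _ → 1) (λ _ xs → lookup xs (fs fz) + lookup xs (fs fz)) X (x ∷ []) ≡ 2 ^ x
    unfold X zero = refl
    unfold X (suc x) rewrite unfold X x = cong (2 ^ x +_) (sym (+-identityʳ (2 ^ x)))

  ifPos : ℕ → ℕ → ℕ → ℕ
  ifPos zero a b = b
  ifPos (suc _) a b = a

  ifPosᶜ : Computable₃ ifPos
  ifPosᶜ = computable₃ (computable-resp (λ { X (zero ∷ a ∷ b ∷ []) → refl ; X (suc c ∷ a ∷ b ∷ []) → refl })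
                                        (primRecᶜ #1 #2))

  leq : ℕ → ℕ → ℕ
  leq x y = ifPos (x ∸ y) 0 1

  leqᶜ : Computable₂ leq
  leqᶜ = computable₂ (call₃ ifPosᶜ (call₂ ∸ᶜ #0 #1) (constᶜ 0) (constᶜ 1))

  leq-yes : ∀ {x y} → x ≤ y → leq x y ≡ 1
  leq-yes p rewrite m≤n⇒m∸n≡0 p = refl

  leq-no : ∀ {x y} → ¬ x ≤ y → leq x y ≡ 0
  leq-no {x} {y} x≰y with x ∸ y in eq
  ... | zero = ⊥-elim (x≰y (m∸n≡0⇒m≤n eq))
  ... | suc _ = refl

  triᶜ : Computable₁ tri
  triᶜ = computable₁ (computable-resp (λ { X (x ∷ []) → unfold X x }) (primRecᶜ zeroᶜ (call₂ +ᶜ (call₁ sucᶜ #0) #1)))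
    where
    unfold : ∀ X x → primRec (λ _ _ → 0) (λ _ xs → suc (lookup xs fz) + lookup xs (fs fz)) X (x ∷ []) ≡ tri x
    unfold X zero = refl
    unfold X (suc x) = cong (suc x +_) (unfold X x)

  pairᶜ : Computable₂ pair
  pairᶜ = computable₂ (call₂ +ᶜ (call₁ triᶜ (call₂ +ᶜ #0 #1)) #1)

  -- triRoot n is the largest t with tri t ≤ n: the diagonal on which n lies.
  triRoot : ℕ → ℕ
  triRoot zero = 0
  triRoot (suc n) = ifPos (leq (tri (suc (triRoot n))) (suc n)) (suc (triRoot n)) (triRoot n)

  triRootᶜ : Computable₁ triRoot
  triRootᶜ = computable₁ (computable-resp (λ { X (x ∷ []) → unfold X x })
    (primRecᶜ zeroᶜ (call₃ ifPosᶜ (call₂ leqᶜ (call₁ triᶜ (call₁ sucᶜ #1)) (call₁ sucᶜ #0)) (call₁ sucᶜ #1) #1)))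
    where
    step : Functional 2
    step _ xs = ifPos (leq (tri (suc (lookup xs (fs fz)))) (suc (lookup xs fz))) (suc (lookup xs (fs fz))) (lookup xs (fs fz))
    unfold : ∀ X x → primRec (λ _ _ → 0) step X (x ∷ []) ≡ triRoot x
    unfold X zero = refl
    unfold X (suc x) rewrite unfold X x = refl

  triRoot-spec : ∀ n → tri (triRoot n) ≤ n × n < tri (suc (triRoot n))
  triRoot-spec zero = z≤n , s≤s z≤n
  triRoot-spec (suc n) with triRoot-spec n | tri (suc (triRoot n)) ≤? suc n
  ... | (l , u) | yes p rewrite leq-yes p = p , s≤s (≤-trans u (m≤n+m (tri (suc (triRoot n))) (suc (triRoot n))))
  ... | (l , u) | no np rewrite leq-no np = m≤n⇒m≤1+n l , ≰⇒> np

  tri-mono : ∀ {t t'} → t < t' → tri (suc t) ≤ tri t'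
  tri-mono {t} {suc t'} (s≤s p) with m≤n⇒m<n∨m≡n p
  ... | inj₂ refl = ≤-refl
  ... | inj₁ q = ≤-trans (tri-mono q) (m≤n+m _ _)

  tri-unique : ∀ {t t' n} → tri t ≤ n → n < tri (suc t) → tri t' ≤ n → n < tri (suc t') → t ≡ t'
  tri-unique {t} {t'} l u l' u' with <-cmp t t'
  ... | tri≈ _ e _ = e
  ... | tri< lt _ _ = ⊥-elim (<⇒≱ u (≤-trans (tri-mono lt) l'))
  ... | tri> _ _ gt = ⊥-elim (<⇒≱ u' (≤-trans (tri-mono gt) l))

  triRoot-diag : ∀ t b → b ≤ t → triRoot (tri t + b) ≡ t
  triRoot-diag t b b≤t =
    tri-unique (proj₁ (triRoot-spec N)) (proj₂ (triRoot-spec N)) (m≤m+n (tri t) b)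
               (subst (N <_) (+-comm (tri t) (suc t)) (+-monoʳ-< (tri t) (s≤s b≤t)))
    where
    N : ℕ
    N = tri t + b

  pairSnd : ℕ → ℕ
  pairSnd n = n ∸ tri (triRoot n)

  pairFst : ℕ → ℕ
  pairFst n = triRoot n ∸ pairSnd n

  pairSndᶜ : Computable₁ pairSnd
  pairSndᶜ = computable₁ (call₂ ∸ᶜ #0 (call₁ triᶜ (call₁ triRootᶜ #0)))

  pairFstᶜ : Computable₁ pairFst
  pairFstᶜ = computable₁ (call₂ ∸ᶜ (call₁ triRootᶜ #0) (call₁ pairSndᶜ #0))

  pairSnd-diag : ∀ t b → b ≤ t → pairSnd (tri t + b) ≡ b
  pairSnd-diag t b b≤t rewrite triRoot-diag t b b≤t = m+n∸m≡n (tri t) b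

  pairSnd-pair : ∀ a b → pairSnd (pair a b) ≡ b
  pairSnd-pair a b = pairSnd-diag (a + b) b (m≤n+m b a)

  pairFst-pair : ∀ a b → pairFst (pair a b) ≡ a
  pairFst-pair a b rewrite triRoot-diag (a + b) b (m≤n+m b a) | m+n∸m≡n (tri (a + b)) b = m+n∸n≡m a b

  -- The enumeration unpair of Defs lists the diagonals, so it inverts pair.
  unpair-diag : ∀ n → tri (proj₁ (unpair n) + proj₂ (unpair n)) + proj₁ (unpair n) ≡ n
  unpair-diag zero = refl
  unpair-diag (suc n) with unpair n | unpair-diag n
  ... | a , zero | e rewrite +-identityʳ a | sym e = cong suc (trans (+-identityʳ _) (+-comm a (tri a)))
  ... | a , suc b | e rewrite +-suc a b | sym e = +-suc _ a

  unpair≡ : ∀ n → unpair n ≡ (pairSnd n , pairFst n)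
  unpair≡ n with unpair n | unpair-diag n
  ... | u , v | e rewrite sym e | pairSnd-diag (u + v) u (m≤m+n u v) | triRoot-diag (u + v) u (m≤m+n u v) =
    cong (u ,_) (sym (m+n∸m≡n u v))

  unpair-pair : ∀ a b → unpair (pair a b) ≡ (b , a)
  unpair-pair a b = trans (unpair≡ (pair a b)) (cong₂ _,_ (pairSnd-pair a b) (pairFst-pair a b))

  -- Parity and halving (they read off the first letter of a coded string).
  parity : ℕ → ℕ
  parity zero = 0
  parity (suc n) = 1 ∸ parity n

  half : ℕ → ℕ
  half zero = 0
  half (suc n) = half n + parity n

  parityᶜ : Computable₁ parity
  parityᶜ = computable₁ (computable-resp (λ { X (x ∷ []) → unfold X x }) (primRecᶜ zeroᶜ (call₂ ∸ᶜ (constᶜ 1) #1)))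
    where
    unfold : ∀ X x → primRec (λ _ _ → 0) (λ _ xs → 1 ∸ lookup xs (fs fz)) X (x ∷ []) ≡ parity x
    unfold X zero = refl
    unfold X (suc x) = cong (1 ∸_) (unfold X x)

  halfᶜ : Computable₁ half
  halfᶜ = computable₁ (computable-resp (λ { X (x ∷ []) → unfold X x }) (primRecᶜ zeroᶜ (call₂ +ᶜ #1 (call₁ parityᶜ #0))))
    where
    unfold : ∀ X x → primRec (λ _ _ → 0) (λ _ xs → lookup xs (fs fz) + parity (lookup xs fz)) X (x ∷ []) ≡ half x
    unfold X zero = refl
    unfold X (suc x) = cong (_+ parity x) (unfold X x)

  parity-even : ∀ n → parity (n + n) ≡ 0
  parity-even zero = refl
  parity-even (suc n) rewrite +-suc n n | parity-even n = refl

  half-even : ∀ n → half (n + n) ≡ n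
  half-even zero = refl
  half-even (suc n) rewrite +-suc n n | parity-even n | half-even n = trans (cong (_+ 1) (+-identityʳ n)) (+-comm n 1)

module Precision where

  open import Defs using (ε)
  open import Data.Nat as ℕ using (ℕ; suc)
  import Data.Nat.Properties as ℕP
  open import Relation.Binary.PropositionalEquality using (_≡_; refl; sym; trans; cong; subst; subst₂)
  open import Data.Integer as ℤ using (+_)
  import Data.Integer.Properties as ℤP
  open import Data.Integer.Solver using (module +-*-Solver)
  open import Data.Rational.Unnormalised using (_≃_; *≡*; *≤*; _≤_; _+_; 0ℚᵘ)
  open +-*-Solver

  ε-nonneg : ∀ j → 0ℚᵘ ≤ ε j
  ε-nonneg j = *≤* (ℤ.+≤+ ℕ.z≤n)

  ε-den : ∀ j → suc (2 ℕ.^ j ℕ.∸ 1) ≡ 2 ℕ.^ j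
  ε-den j = trans (sym (ℕP.+-∸-assoc 1 (ℕP.m^n>0 2 j))) (ℕP.m+n∸m≡n 1 (2 ℕ.^ j))

  ε-halves : ∀ j → ε (suc j) + ε (suc j) ≃ ε j
  ε-halves j = *≡* (cross (suc (2 ℕ.^ j ℕ.∸ 1)) (suc (2 ℕ.^ suc j ℕ.∸ 1))
                          (trans (ε-den (suc j)) (cong (2 ℕ.*_) (sym (ε-den j)))))
    where
    identity : ∀ x → (+ 1 ℤ.* (+ 2 ℤ.* x) ℤ.+ + 1 ℤ.* (+ 2 ℤ.* x)) ℤ.* x ≡ + 1 ℤ.* ((+ 2 ℤ.* x) ℤ.* (+ 2 ℤ.* x))
    identity = solve 1 (λ x → (con (+ 1) :* (con (+ 2) :* x) :+ con (+ 1) :* (con (+ 2) :* x)) :* x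
                               := con (+ 1) :* ((con (+ 2) :* x) :* (con (+ 2) :* x))) refl
    cross : ∀ E D → D ≡ 2 ℕ.* E → (+ 1 ℤ.* + D ℤ.+ + 1 ℤ.* + D) ℤ.* + E ≡ + 1 ℤ.* + (D ℕ.* D)
    cross E D refl = trans (subst (λ d → (+ 1 ℤ.* d ℤ.+ + 1 ℤ.* d) ℤ.* + E ≡ + 1 ℤ.* (d ℤ.* d)) (sym (ℤP.pos-* 2 E)) (identity (+ E)))
                           (cong (+ 1 ℤ.*_) (sym (ℤP.pos-* (2 ℕ.* E) (2 ℕ.* E))))

  ε-anti : ∀ {i j} → i ℕ.≤ j → ε j ≤ ε i
  ε-anti {i} {j} i≤j = *≤* (ℤ.+≤+ (subst₂ ℕ._≤_ (sym (trans (ℕP.+-identityʳ _) (ε-den i)))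
                                                 (sym (trans (ℕP.+-identityʳ _) (ε-den j)))
                                                 (ℕP.^-monoʳ-≤ 2 i≤j)))

module Closeness where

  open import Defs using (ε)
  open Precision
  open import Data.Nat as ℕ using (ℕ; suc)
  import Data.Nat.Properties as ℕP
  open import Data.Sum using (inj₁; inj₂)
  open import Data.Integer using (+_)
  open import Data.Rational.Unnormalised as ℚ using (ℚᵘ; mkℚᵘ; _≃_; _≤_; _+_; _-_; -_; 0ℚᵘ; ∣_∣)
  import Data.Rational.Unnormalised.Properties as ℚP
  open ℚP using (≃-refl; ≃-sym; ≃-trans; ≤-trans; ≤-respˡ-≃; ≤-respʳ-≃; +-mono-≤)
  open import Data.Rational.Unnormalised.Solver using (module +-*-Solver)
  open +-*-Solver

  NonNeg : ℚᵘ → Set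
  NonNeg x = 0ℚᵘ ≤ x

  nonneg-+ : ∀ {x y} → NonNeg x → NonNeg y → NonNeg (x + y)
  nonneg-+ a b = ≤-respˡ-≃ (ℚP.+-identityˡ 0ℚᵘ) (+-mono-≤ a b)

  sum-bound : ∀ {x y z t u} → x ≃ y + z → y ≤ t → z ≤ u → x ≤ t + u
  sum-bound e p q = ≤-respˡ-≃ (≃-sym e) (+-mono-≤ p q)

  sub-monoˡ : ∀ {x x'} y → x ≤ x' → x - y ≤ x' - y
  sub-monoˡ y p = ℚP.+-monoˡ-≤ (- y) p

  sub-monoʳ : ∀ x {y y'} → y ≤ y' → x - y' ≤ x - y
  sub-monoʳ x p = ℚP.+-monoʳ-≤ x (ℚP.neg-mono-≤ p)

  ≤-plusˡ : ∀ {a x} → NonNeg a → x ≤ a + x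
  ≤-plusˡ {a} {x} na = ≤-respˡ-≃ (ℚP.+-identityˡ x) (ℚP.+-monoˡ-≤ x na)

  ≤-plusʳ : ∀ {a x} → NonNeg a → x ≤ x + a
  ≤-plusʳ {a} {x} na = ≤-respˡ-≃ (ℚP.+-identityʳ x) (ℚP.+-monoʳ-≤ x na)

  neg-sub : ∀ a b → - (a - b) ≃ b - a
  neg-sub = solve 2 (λ a b → :- (a :- b) := b :- a) ≃-refl

  neg≤self : ∀ {x} → NonNeg x → - x ≤ x
  neg≤self nx = ≤-trans (ℚP.neg-mono-≤ nx) nx

  neg-flip : ∀ {y δ} → - δ ≤ y → - y ≤ δ
  neg-flip {y} {δ} -δ≤y = ≤-respʳ-≃ (ℚP.neg-involutive δ) (ℚP.neg-mono-≤ -δ≤y)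

  -- Close t a b: a and b differ by at most t, i.e. |a - b| ≤ t split into its two halves.
  record Close (t a b : ℚᵘ) : Set where
    constructor close
    field
      lo : a - b ≤ t
      hi : b - a ≤ t
  open Close public

  close-refl : ∀ {t} a → NonNeg t → Close t a a
  close-refl {t} a nt = close bound bound
    where
    bound : a - a ≤ t
    bound = ≤-respˡ-≃ (≃-sym (ℚP.+-inverseʳ a)) nt

  close-sym : ∀ {t a b} → Close t a b → Close t b a
  close-sym (close p q) = close q p

  close-mono : ∀ {t u a b} → t ≤ u → Close t a b → Close u a b
  close-mono tu (close p q) = close (≤-trans p tu) (≤-trans q tu)

  close-resp : ∀ {t a a' b b'} → a ≃ a' → b ≃ b' → Close t a b → Close t a' b'
  close-resp ea eb (close p q) =
    close (≤-respˡ-≃ (ℚP.+-cong ea (ℚP.-‿cong eb)) p) (≤-respˡ-≃ (ℚP.+-cong eb (ℚP.-‿cong ea)) q)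

  close-trans : ∀ {t u a b c} → Close t a b → Close u b c → Close (t + u) a c
  close-trans {a = a} {b} {c} (close p q) (close p' q') = close (sum-bound (split a b c) p p') (sum-bound (split' a b c) q q')
    where
    split : ∀ a b c → a - c ≃ (a - b) + (b - c)
    split = solve 3 (λ a b c → a :- c := (a :- b) :+ (b :- c)) ≃-refl
    split' : ∀ a b c → c - a ≃ (b - a) + (c - b)
    split' = solve 3 (λ a b c → c :- a := (b :- a) :+ (c :- b)) ≃-refl

  close-add : ∀ {t u a a' b b'} → Close t a a' → Close u b b' → Close (t + u) (a + b) (a' + b')
  close-add {a = a} {a'} {b} {b'} (close p q) (close p' q') =
    close (sum-bound (split a a' b b') p p') (sum-bound (split a' a b' b) q q')
    where
    split : ∀ a a' b b' → (a + b) - (a' + b') ≃ (a - a') + (b - b')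
    split = solve 4 (λ a a' b b' → (a :+ b) :- (a' :+ b') := (a :- a') :+ (b :- b')) ≃-refl

  close-sub : ∀ {t u a a' b b'} → Close t a a' → Close u b b' → Close (t + u) (a - b) (a' - b')
  close-sub {a = a} {a'} {b} {b'} (close p q) (close p' q') =
    close (sum-bound (split a a' b b') p q') (sum-bound (split a' a b' b) q p')
    where
    split : ∀ a a' b b' → (a - b) - (a' - b') ≃ (a - a') + (b' - b)
    split = solve 4 (λ a a' b b' → (a :- b) :- (a' :- b') := (a :- a') :+ (b' :- b)) ≃-refl

  close-addˡ : ∀ {t} a {b b'} → Close t b b' → Close t (a + b) (a + b')
  close-addˡ a {b} {b'} (close p q) = close (≤-respˡ-≃ (shift a b b') p) (≤-respˡ-≃ (shift a b' b) q)
    where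
    shift : ∀ a b b' → b - b' ≃ (a + b) - (a + b')
    shift = solve 3 (λ a b b' → b :- b' := (a :+ b) :- (a :+ b')) ≃-refl

  close-solve : ∀ {t a b s} → Close t (a + b) s → Close t (s - a) b
  close-solve {a = a} {b} {s} (close p q) = close (≤-respˡ-≃ (e₁ a b s) q) (≤-respˡ-≃ (e₂ a b s) p)
    where
    e₁ : ∀ a b s → s - (a + b) ≃ (s - a) - b
    e₁ = solve 3 (λ a b s → s :- (a :+ b) := (s :- a) :- b) ≃-refl
    e₂ : ∀ a b s → (a + b) - s ≃ b - (s - a)
    e₂ = solve 3 (λ a b s → (a :+ b) :- s := b :- (s :- a)) ≃-refl

  close⇒abs : ∀ {t a b} → Close t a b → ∣ a - b ∣ ≤ t
  close⇒abs {a = a} {b} (close p q) with ℚP.∣p∣≡p∨∣p∣≡-p (a - b)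
  ... | inj₁ e rewrite e = p
  ... | inj₂ e rewrite e = ≤-respˡ-≃ (≃-sym (neg-sub a b)) q

  abs⇒close : ∀ {t a b} → ∣ a - b ∣ ≤ t → Close t a b
  abs⇒close {a = a} {b} h with ℚP.∣p∣≡p∨∣p∣≡-p (a - b) | ℚP.0≤∣p∣ (a - b)
  ... | inj₁ e | nonneg rewrite e = close h (≤-trans (≤-respˡ-≃ (neg-sub a b) (neg≤self nonneg)) h)
  ... | inj₂ e | nonneg rewrite e = close (≤-trans (≤-respˡ-≃ (ℚP.neg-involutive (a - b)) (neg≤self nonneg)) h)
                                          (≤-respˡ-≃ (neg-sub a b) h)

  excess-bound : ∀ {q e δ x y g w} → Close q (x + y) (g + g) → - δ ≤ y → Close e w g → x - (w + w) ≤ (e + e) + (q + δ)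
  excess-bound {x = x} {y} {g} {w} (close defect _) -δ≤y (close _ g-w≤e) =
    sum-bound (split x y g w) (+-mono-≤ g-w≤e g-w≤e) (sum-bound ≃-refl defect (neg-flip -δ≤y))
    where
    split : ∀ x y g w → x - (w + w) ≃ ((g - w) + (g - w)) + (((x + y) - (g + g)) + - y)
    split = solve 4 (λ x y g w → x :- (w :+ w) := ((g :- w) :+ (g :- w)) :+ (((x :+ y) :- (g :+ g)) :+ :- y)) ≃-refl

  -- Error budgets: eight errors of size ε (3 ℕ.+ j) add up to ε j.
  module Budget (j : ℕ) where

    private
      e 2e : ℚᵘ
      e = ε (3 ℕ.+ j)
      2e = e + e
      2e-nonneg : NonNeg 2e
      2e-nonneg = nonneg-+ (ε-nonneg (3 ℕ.+ j)) (ε-nonneg (3 ℕ.+ j))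

    four-errors : 2e + 2e ≃ ε (suc j)
    four-errors = ≃-trans (ℚP.+-cong (ε-halves (2 ℕ.+ j)) (ε-halves (2 ℕ.+ j))) (ε-halves (1 ℕ.+ j))

    four-errors≤ : 2e + 2e ≤ ε j
    four-errors≤ = ≤-trans (ℚP.≤-reflexive four-errors) (ε-anti (ℕP.n≤1+n j))

    two-errors≤ : 2e ≤ ε j
    two-errors≤ = ≤-trans (≤-plusʳ 2e-nonneg) four-errors≤

    -- Bounds used when the approximations q (martingale defect) and δ (negativity) are at most e.
    three-errors≤ : ∀ {q δ} → q ≤ e → δ ≤ e → 2e + (q + δ) ≤ ε j
    three-errors≤ q≤e δ≤e = ≤-trans (ℚP.+-monoʳ-≤ 2e (+-mono-≤ q≤e δ≤e)) four-errors≤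

    seven-errors≤ : ∀ {q δ} → q ≤ e → δ ≤ e → (2e + (2e + (q + δ))) + q ≤ ε j
    seven-errors≤ {q} {δ} q≤e δ≤e = begin
      (2e + (2e + (q + δ))) + q     ≤⟨ +-mono-≤ (ℚP.+-monoʳ-≤ 2e (ℚP.+-monoʳ-≤ 2e (+-mono-≤ q≤e δ≤e))) q≤2e ⟩
      (2e + (2e + 2e)) + 2e         ≃⟨ regroup 2e ⟩
      (2e + 2e) + (2e + 2e)         ≃⟨ ℚP.+-cong four-errors four-errors ⟩
      ε (suc j) + ε (suc j)         ≃⟨ ε-halves j ⟩
      ε j                           ∎
      where
      open ℚP.≤-Reasoning
      q≤2e : q ≤ 2e
      q≤2e = ≤-trans q≤e (≤-plusʳ (ε-nonneg (3 ℕ.+ j)))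
      regroup : ∀ a → (a + (a + a)) + a ≃ (a + a) + (a + a)
      regroup = solve 1 (λ a → (a :+ (a :+ a)) :+ a := (a :+ a) :+ (a :+ a)) ≃-refl

  four-copies : ∀ x → mkℚᵘ (+ 4) 0 ℚ.* x ≃ (x + x) + (x + x)
  four-copies = solve 1 (λ x → con (mkℚᵘ (+ 4) 0) :* x := (x :+ x) :+ (x :+ x)) ≃-refl

  four-ε≤ : ∀ i p → 2 ℕ.+ i ℕ.≤ p → (ε p + ε p) + (ε p + ε p) ≤ ε i
  four-ε≤ i p 2+i≤p = begin
    (ε p + ε p) + (ε p + ε p)                                  ≤⟨ +-mono-≤ (+-mono-≤ εp≤ εp≤) (+-mono-≤ εp≤ εp≤) ⟩
    (ε (2 ℕ.+ i) + ε (2 ℕ.+ i)) + (ε (2 ℕ.+ i) + ε (2 ℕ.+ i))  ≃⟨ ℚP.+-cong (ε-halves (1 ℕ.+ i)) (ε-halves (1 ℕ.+ i)) ⟩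
    ε (1 ℕ.+ i) + ε (1 ℕ.+ i)                                  ≃⟨ ε-halves i ⟩
    ε i                                                         ∎
    where
    open ℚP.≤-Reasoning
    εp≤ : ε p ≤ ε (2 ℕ.+ i)
    εp≤ = ε-anti 2+i≤p

module Clamping where

  open Closeness
  open import Data.Product using (Σ; _×_; _,_)
  open import Data.Sum using (_⊎_; inj₁; inj₂)
  open import Data.Rational.Unnormalised using (ℚᵘ; _≃_; _≤_; _<_; _+_; _-_; -_; 0ℚᵘ)
  open import Data.Rational.Unnormalised.Properties
    using (≃-refl; ≃-sym; ≃-trans; ≤-refl; ≤-trans; ≤-reflexive; ≤-respˡ-≃; ≤-respʳ-≃; <-respˡ-≃; <⇒≤;
           +-congˡ; +-congʳ; -‿cong; +-identityˡ; +-identityʳ; module ≤-Reasoning)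

  MaxSel MinSel : ℚᵘ → ℚᵘ → ℚᵘ → Set
  MaxSel r a b = (a ≤ b × r ≃ b) ⊎ (b < a × r ≃ a)
  MinSel r a b = (a ≤ b × r ≃ a) ⊎ (b < a × r ≃ b)

  Clamp : ℚᵘ → ℚᵘ → ℚᵘ → Set
  Clamp c x z = Σ ℚᵘ λ m → MaxSel m x 0ℚᵘ × MinSel c m z

  minSel-resp : ∀ {c m z z'} → z ≃ z' → MinSel c m z → MinSel c m z'
  minSel-resp e (inj₁ (p , q)) = inj₁ (≤-respʳ-≃ e p , q)
  minSel-resp e (inj₂ (p , q)) = inj₂ (<-respˡ-≃ e p , ≃-trans q e)

  close-max : ∀ {t a a' b b' r r'} → Close t a a' → Close t b b' → MaxSel r a b → MaxSel r' a' b' → Close t r r'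
  close-max ca cb (inj₁ (_ , e)) (inj₁ (_ , e')) = close-resp (≃-sym e) (≃-sym e') cb
  close-max ca cb (inj₂ (_ , e)) (inj₂ (_ , e')) = close-resp (≃-sym e) (≃-sym e') ca
  close-max {a' = a'} {b = b} ca cb (inj₁ (a≤b , e)) (inj₂ (b'<a' , e')) =
    close-resp (≃-sym e) (≃-sym e') (close (≤-trans (sub-monoʳ b (<⇒≤ b'<a')) (lo cb)) (≤-trans (sub-monoʳ a' a≤b) (hi ca)))
  close-max {a = a} {b' = b'} ca cb (inj₂ (b<a , e)) (inj₁ (a'≤b' , e')) =
    close-resp (≃-sym e) (≃-sym e') (close (≤-trans (sub-monoʳ a a'≤b') (lo ca)) (≤-trans (sub-monoʳ b' (<⇒≤ b<a)) (hi cb)))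

  close-min : ∀ {t a a' b b' r r'} → Close t a a' → Close t b b' → MinSel r a b → MinSel r' a' b' → Close t r r'
  close-min ca cb (inj₁ (_ , e)) (inj₁ (_ , e')) = close-resp (≃-sym e) (≃-sym e') ca
  close-min ca cb (inj₂ (_ , e)) (inj₂ (_ , e')) = close-resp (≃-sym e) (≃-sym e') cb
  close-min {a = a} {b' = b'} ca cb (inj₁ (a≤b , e)) (inj₂ (b'<a' , e')) =
    close-resp (≃-sym e) (≃-sym e') (close (≤-trans (sub-monoˡ b' a≤b) (lo cb)) (≤-trans (sub-monoˡ a (<⇒≤ b'<a')) (hi ca)))
  close-min {a' = a'} {b = b} ca cb (inj₂ (b<a , e)) (inj₁ (a'≤b' , e')) =
    close-resp (≃-sym e) (≃-sym e') (close (≤-trans (sub-monoˡ a' (<⇒≤ b<a)) (lo ca)) (≤-trans (sub-monoˡ b a'≤b') (hi cb)))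

  clamp-close : ∀ {t c c' x x' z z'} → NonNeg t → Close t x x' → Close t z z' →
                Clamp c x z → Clamp c' x' z' → Close t c c'
  clamp-close nt cx cz (m , ms , mn) (m' , ms' , mn') = close-min (close-max cx (close-refl 0ℚᵘ nt) ms ms') cz mn mn'

  max0-nonneg : ∀ {m x} → MaxSel m x 0ℚᵘ → NonNeg m
  max0-nonneg (inj₁ (_ , e)) = ≤-respʳ-≃ (≃-sym e) ≤-refl
  max0-nonneg (inj₂ (0<x , e)) = ≤-respʳ-≃ (≃-sym e) (<⇒≤ 0<x)

  clamp-bounds : ∀ {c x z} → NonNeg z → Clamp c x z → NonNeg c × c ≤ z
  clamp-bounds nz (m , ms , inj₁ (m≤z , e)) = ≤-respʳ-≃ (≃-sym e) (max0-nonneg ms) , ≤-respˡ-≃ (≃-sym e) m≤z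
  clamp-bounds nz (m , ms , inj₂ (_ , e)) = ≤-respʳ-≃ (≃-sym e) nz , ≤-reflexive e

  max0-near : ∀ {m x δ} → MaxSel m x 0ℚᵘ → - δ ≤ x → NonNeg δ → Close δ m x
  max0-near {m} {x} {δ} (inj₁ (x≤0 , e)) -δ≤x nδ = close below above
    where
    open ≤-Reasoning
    below : m - x ≤ δ
    below = begin
      m - x      ≃⟨ +-congˡ (- x) e ⟩
      0ℚᵘ - x    ≃⟨ +-identityˡ (- x) ⟩
      - x        ≤⟨ neg-flip -δ≤x ⟩
      δ          ∎
    above : x - m ≤ δ
    above = begin
      x - m      ≃⟨ +-congʳ x (-‿cong e) ⟩
      x - 0ℚᵘ    ≃⟨ +-identityʳ x ⟩
      x          ≤⟨ x≤0 ⟩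
      0ℚᵘ        ≤⟨ nδ ⟩
      δ          ∎
  max0-near (inj₂ (_ , e)) _ nδ = close-resp (≃-sym e) ≃-refl (close-refl _ nδ)

  clamp-near : ∀ {c x z δ u} → Clamp c x z → - δ ≤ x → NonNeg δ → δ ≤ u → x - z ≤ u → Close u c x
  clamp-near {c} {x} {z} {δ} {u} (m , ms , mn) -δ≤x nδ δ≤u x-z≤u = close (below mn) (above mn)
    where
    m≈x : Close δ m x
    m≈x = max0-near ms -δ≤x nδ
    below : MinSel c m z → c - x ≤ u
    below (inj₁ (_ , e)) = ≤-respˡ-≃ (+-congˡ (- x) (≃-sym e)) (≤-trans (lo m≈x) δ≤u)
    below (inj₂ (z<m , e)) = ≤-trans (sub-monoˡ x (≤-respˡ-≃ (≃-sym e) (<⇒≤ z<m))) (≤-trans (lo m≈x) δ≤u)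
    above : MinSel c m z → x - c ≤ u
    above (inj₁ (_ , e)) = ≤-respˡ-≃ (+-congʳ x (-‿cong (≃-sym e))) (≤-trans (hi m≈x) δ≤u)
    above (inj₂ (_ , e)) = ≤-respˡ-≃ (+-congʳ x (-‿cong (≃-sym e))) x-z≤u

module RationalCodes where

  open import Defs
  open Computability
  open Arithmetic
  open Clamping using (MaxSel; MinSel; Clamp)
  open import Data.Nat as ℕ using (ℕ; suc; _+_; _*_; _∸_; _^_)
  open import Data.Product using (_×_; _,_)
  open import Data.Sum using (_⊎_; inj₁; inj₂)
  open import Function using (_$_)
  open import Relation.Binary.PropositionalEquality
  open import Relation.Nullary using (¬_; yes; no)
  open import Data.Empty using (⊥-elim)
  open import Data.Nat.Properties using (0≢1+n)
  open import Data.Nat.Solver using () renaming (module +-*-Solver to ℕ-Solver)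
  open import Data.Integer as ℤ using (ℤ; +_)
  import Data.Integer.Properties as ℤP
  open import Data.Integer.Solver using () renaming (module +-*-Solver to ℤ-Solver)
  open import Data.Rational.Unnormalised as ℚ using (ℚᵘ; mkℚᵘ; _≃_; *≡*; *≤*)
  import Data.Rational.Unnormalised.Properties as ℚP

  ⟦_⟧ : ℕ → ℚᵘ
  ⟦ n ⟧ = decodeℚ n

  ratCode : ℕ → ℕ → ℕ → ℕ
  ratCode x y m = pair m (pair y x)

  numPos numNeg denPred : ℕ → ℕ
  numPos n = pairSnd (pairSnd n)
  numNeg n = pairFst (pairSnd n)
  denPred n = pairFst n

  den : ℕ → ℕ
  den n = suc (denPred n)

  decode-unpair : ∀ n p m a b → unpair n ≡ (p , m) → unpair p ≡ (a , b) → ⟦ n ⟧ ≡ mkℚᵘ (+ a ℤ.- + b) m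
  decode-unpair n p m a b e₁ e₂ with unpair n | e₁
  ... | .(p , m) | refl with unpair p | e₂
  ... | .(a , b) | refl = refl

  decode-ratCode : ∀ x y m → ⟦ ratCode x y m ⟧ ≡ mkℚᵘ (+ x ℤ.- + y) m
  decode-ratCode x y m = decode-unpair (ratCode x y m) _ _ _ _ (unpair-pair m (pair y x)) (unpair-pair y x)

  decode-parts : ∀ n → ⟦ n ⟧ ≡ mkℚᵘ (+ numPos n ℤ.- + numNeg n) (denPred n)
  decode-parts n = decode-unpair n _ _ _ _ (unpair≡ n) (unpair≡ (pairSnd n))

  ratCodeᶜ : Computable₃ ratCode
  ratCodeᶜ = computable₃ (call₂ pairᶜ #2 (call₂ pairᶜ #1 #0))

  numPosᶜ : Computable₁ numPos
  numPosᶜ = computable₁ (call₁ pairSndᶜ (call₁ pairSndᶜ #0))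

  numNegᶜ : Computable₁ numNeg
  numNegᶜ = computable₁ (call₁ pairFstᶜ (call₁ pairSndᶜ #0))

  denPredᶜ : Computable₁ denPred
  denPredᶜ = computable₁ (call₁ pairFstᶜ #0)

  denᶜ : Computable₁ den
  denᶜ = computable₁ (call₁ sucᶜ (call₁ denPredᶜ #0))

  sub≤sub⇒ : ∀ a b c d → a ℤ.- b ℤ.≤ c ℤ.- d → a ℤ.+ d ℤ.≤ c ℤ.+ b
  sub≤sub⇒ a b c d h = subst₂ ℤ._≤_ (eˡ a b d) (eʳ c d b) (ℤP.+-monoˡ-≤ (b ℤ.+ d) h)
    where
    open ℤ-Solver hiding (⟦_⟧)
    eˡ : ∀ a b d → (a ℤ.- b) ℤ.+ (b ℤ.+ d) ≡ a ℤ.+ d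
    eˡ = solve 3 (λ a b d → (a :- b) :+ (b :+ d) := a :+ d) refl
    eʳ : ∀ c d b → (c ℤ.- d) ℤ.+ (b ℤ.+ d) ≡ c ℤ.+ b
    eʳ = solve 3 (λ c d b → (c :- d) :+ (b :+ d) := c :+ b) refl

  sub≤sub⇐ : ∀ a b c d → a ℤ.+ d ℤ.≤ c ℤ.+ b → a ℤ.- b ℤ.≤ c ℤ.- d
  sub≤sub⇐ a b c d h = subst₂ ℤ._≤_ (eˡ a d b) (eʳ c b d) (ℤP.+-monoˡ-≤ (ℤ.- (b ℤ.+ d)) h)
    where
    open ℤ-Solver hiding (⟦_⟧)
    eˡ : ∀ a d b → (a ℤ.+ d) ℤ.+ ℤ.- (b ℤ.+ d) ≡ a ℤ.- b
    eˡ = solve 3 (λ a d b → (a :+ d) :+ :- (b :+ d) := a :- b) refl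
    eʳ : ∀ c b d → (c ℤ.+ b) ℤ.+ ℤ.- (b ℤ.+ d) ≡ c ℤ.- d
    eʳ = solve 3 (λ c b d → (c :+ b) :+ :- (b :+ d) := c :- d) refl

  *-distrib-sub : ∀ x y d → (+ x ℤ.- + y) ℤ.* + d ≡ + (x * d) ℤ.- + (y * d)
  *-distrib-sub x y d rewrite ℤP.pos-* x d | ℤP.pos-* y d = e (+ x) (+ y) (+ d)
    where
    open ℤ-Solver hiding (⟦_⟧)
    e : ∀ a b c → (a ℤ.- b) ℤ.* c ≡ a ℤ.* c ℤ.- b ℤ.* c
    e = solve 3 (λ a b c → (a :- b) :* c := a :* c :- b :* c) refl

  CrossLe : ℕ → ℕ → Set
  CrossLe u v = numPos u * den v + numNeg v * den u ℕ.≤ numPos v * den u + numNeg u * den v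

  ≤⇒crossLe : ∀ u v → ⟦ u ⟧ ℚ.≤ ⟦ v ⟧ → CrossLe u v
  ≤⇒crossLe u v u≤v with subst₂ ℚ._≤_ (decode-parts u) (decode-parts v) u≤v
  ... | *≤* h = ℤP.drop‿+≤+ (subst₂ ℤ._≤_ (sym (ℤP.pos-+ (numPos u * den v) (numNeg v * den u))) (sym (ℤP.pos-+ (numPos v * den u) (numNeg u * den v)))
    (sub≤sub⇒ (+ (numPos u * den v)) (+ (numNeg u * den v)) (+ (numPos v * den u)) (+ (numNeg v * den u))
      (subst₂ ℤ._≤_ (*-distrib-sub (numPos u) (numNeg u) (den v)) (*-distrib-sub (numPos v) (numNeg v) (den u)) h)))

  crossLe⇒≤ : ∀ u v → CrossLe u v → ⟦ u ⟧ ℚ.≤ ⟦ v ⟧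
  crossLe⇒≤ u v h = subst₂ ℚ._≤_ (sym (decode-parts u)) (sym (decode-parts v)) $
    *≤* (subst₂ ℤ._≤_ (sym (*-distrib-sub (numPos u) (numNeg u) (den v))) (sym (*-distrib-sub (numPos v) (numNeg v) (den u)))
      (sub≤sub⇐ (+ (numPos u * den v)) (+ (numNeg u * den v)) (+ (numPos v * den u)) (+ (numNeg v * den u)) (subst₂ ℤ._≤_ (ℤP.pos-+ (numPos u * den v) (numNeg v * den u)) (ℤP.pos-+ (numPos v * den u) (numNeg u * den v)) (ℤ.+≤+ h))))

  -- Exact addition of codes: (a/d + c/e) = (a e + c d)/(d e).
  addQ-sem-num : ∀ u v →
    + (numPos u * den v + numPos v * den u) ℤ.- + (numNeg u * den v + numNeg v * den u)
    ≡ (+ numPos u ℤ.- + numNeg u) ℤ.* + den v ℤ.+ (+ numPos v ℤ.- + numNeg v) ℤ.* + den u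
  addQ-sem-num u v = trans (cong₂ ℤ._-_ (cast (numPos u) (den v) (numPos v) (den u)) (cast (numNeg u) (den v) (numNeg v) (den u)))
                           (e (+ numPos u) (+ numNeg u) (+ numPos v) (+ numNeg v) (+ den u) (+ den v))
    where
    open ℤ-Solver hiding (⟦_⟧)
    cast : ∀ a b c d → + (a * b + c * d) ≡ + a ℤ.* + b ℤ.+ + c ℤ.* + d
    cast a b c d = trans (ℤP.pos-+ (a * b) (c * d)) (cong₂ ℤ._+_ (ℤP.pos-* a b) (ℤP.pos-* c d))
    e : ∀ a b c d p q → (a ℤ.* q ℤ.+ c ℤ.* p) ℤ.- (b ℤ.* q ℤ.+ d ℤ.* p) ≡ (a ℤ.- b) ℤ.* q ℤ.+ (c ℤ.- d) ℤ.* p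
    e = solve 6 (λ a b c d p q → (a :* q :+ c :* p) :- (b :* q :+ d :* p) := (a :- b) :* q :+ (c :- d) :* p) refl

  den-* : ∀ a b → suc (a * b + a + b) ≡ suc a * suc b
  den-* a b = cong suc (solve 2 (λ a b → a :* b :+ a :+ b := b :+ a :* (con 1 :+ b)) refl a b)
    where open ℕ-Solver

  -- The arithmetic on codes is sealed: clients only use the specifications below.
  opaque
    leQ : ℕ → ℕ → ℕ
    leQ u v = leq (numPos u * den v + numNeg v * den u) (numPos v * den u + numNeg u * den v)

    addQ subQ maxQ clampQ : ℕ → ℕ → ℕ
    addQ u v = ratCode (numPos u * den v + numPos v * den u) (numNeg u * den v + numNeg v * den u)
                       (denPred u * denPred v + denPred u + denPred v)

    negQ dblQ epsQ : ℕ → ℕ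
    negQ u = ratCode (numNeg u) (numPos u) (denPred u)

    subQ u v = addQ u (negQ v)
    dblQ u = addQ u u

    epsQ i = ratCode 1 0 (2 ^ i ∸ 1)

    maxQ x z = ifPos (leQ x z) z x

    clampQ x z = let m = maxQ x 0 in ifPos (leQ m z) m z

    leQ-complete : ∀ u v → ⟦ u ⟧ ℚ.≤ ⟦ v ⟧ → leQ u v ≡ 1
    leQ-complete u v h = leq-yes (≤⇒crossLe u v h)

    leQ-sound : ∀ u v → ¬ (leQ u v ≡ 0) → ⟦ u ⟧ ℚ.≤ ⟦ v ⟧
    leQ-sound u v h with ⟦ u ⟧ ℚP.≤? ⟦ v ⟧
    ... | yes p = p
    ... | no np = ⊥-elim (h (leq-no λ c → np (crossLe⇒≤ u v c)))

    addQ-sem : ∀ u v → ⟦ addQ u v ⟧ ≃ ⟦ u ⟧ ℚ.+ ⟦ v ⟧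
    addQ-sem u v =
      subst₂ _≃_ (sym (decode-ratCode (numPos u * den v + numPos v * den u) (numNeg u * den v + numNeg v * den u)
                                      (denPred u * denPred v + denPred u + denPred v)))
                 (cong₂ ℚ._+_ (sym (decode-parts u)) (sym (decode-parts v)))
                 (*≡* (cong₂ ℤ._*_ (addQ-sem-num u v) (cong +_ (sym (den-* (denPred u) (denPred v))))))

    negQ-sem : ∀ u → ⟦ negQ u ⟧ ≃ ℚ.- ⟦ u ⟧
    negQ-sem u =
      subst₂ _≃_ (sym (decode-ratCode (numNeg u) (numPos u) (denPred u))) (cong ℚ.-_ (sym (decode-parts u)))
                 (*≡* (cong (ℤ._* + den u) (e (+ numNeg u) (+ numPos u))))
      where
      open ℤ-Solver hiding (⟦_⟧)
      e : ∀ a b → a ℤ.- b ≡ ℤ.- (b ℤ.- a)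
      e = solve 2 (λ a b → a :- b := :- (b :- a)) refl

    subQ-sem : ∀ u v → ⟦ subQ u v ⟧ ≃ ⟦ u ⟧ ℚ.- ⟦ v ⟧
    subQ-sem u v = ℚP.≃-trans (addQ-sem u (negQ v)) (ℚP.+-congʳ ⟦ u ⟧ (negQ-sem v))

    dblQ-sem : ∀ u → ⟦ dblQ u ⟧ ≃ ⟦ u ⟧ ℚ.+ ⟦ u ⟧
    dblQ-sem u = addQ-sem u u

    epsQ-sem : ∀ i → ⟦ epsQ i ⟧ ≡ ε i
    epsQ-sem i = decode-ratCode 1 0 (2 ^ i ∸ 1)

    select : ∀ x z a b → (⟦ x ⟧ ℚ.≤ ⟦ z ⟧ × ifPos (leQ x z) a b ≡ a) ⊎ (⟦ z ⟧ ℚ.< ⟦ x ⟧ × ifPos (leQ x z) a b ≡ b)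
    select x z a b with ⟦ x ⟧ ℚP.≤? ⟦ z ⟧
    ... | yes p rewrite leQ-complete x z p = inj₁ (p , refl)
    ... | no np with leQ x z in eq
    ...   | 0 = inj₂ (ℚP.≰⇒> np , refl)
    ...   | suc _ = ⊥-elim (np (leQ-sound x z λ e → 0≢1+n (trans (sym e) eq)))

    maxQ-sel : ∀ x z → MaxSel ⟦ maxQ x z ⟧ ⟦ x ⟧ ⟦ z ⟧
    maxQ-sel x z with select x z z x
    ... | inj₁ (p , e) rewrite e = inj₁ (p , ℚP.≃-refl)
    ... | inj₂ (p , e) rewrite e = inj₂ (p , ℚP.≃-refl)

    clampQ-sel : ∀ x z → Clamp ⟦ clampQ x z ⟧ ⟦ x ⟧ ⟦ z ⟧
    clampQ-sel x z = ⟦ maxQ x 0 ⟧ , maxQ-sel x 0 , minSel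
      where
      minSel : MinSel ⟦ clampQ x z ⟧ ⟦ maxQ x 0 ⟧ ⟦ z ⟧
      minSel with select (maxQ x 0) z (maxQ x 0) z
      ... | inj₁ (p , e) rewrite e = inj₁ (p , ℚP.≃-refl)
      ... | inj₂ (p , e) rewrite e = inj₂ (p , ℚP.≃-refl)

    leQᶜ : Computable₂ leQ
    leQᶜ = computable₂ (call₂ leqᶜ (call₂ +ᶜ (call₂ *ᶜ (call₁ numPosᶜ #0) (call₁ denᶜ #1)) (call₂ *ᶜ (call₁ numNegᶜ #1) (call₁ denᶜ #0)))
                                     (call₂ +ᶜ (call₂ *ᶜ (call₁ numPosᶜ #1) (call₁ denᶜ #0)) (call₂ *ᶜ (call₁ numNegᶜ #0) (call₁ denᶜ #1))))

    addQᶜ : Computable₂ addQ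
    addQᶜ = computable₂ (call₃ ratCodeᶜ (call₂ +ᶜ (call₂ *ᶜ (call₁ numPosᶜ #0) (call₁ denᶜ #1)) (call₂ *ᶜ (call₁ numPosᶜ #1) (call₁ denᶜ #0)))
                                       (call₂ +ᶜ (call₂ *ᶜ (call₁ numNegᶜ #0) (call₁ denᶜ #1)) (call₂ *ᶜ (call₁ numNegᶜ #1) (call₁ denᶜ #0)))
                                       (call₂ +ᶜ (call₂ +ᶜ (call₂ *ᶜ (call₁ denPredᶜ #0) (call₁ denPredᶜ #1)) (call₁ denPredᶜ #0)) (call₁ denPredᶜ #1)))

    negQᶜ : Computable₁ negQ
    negQᶜ = computable₁ (call₃ ratCodeᶜ (call₁ numNegᶜ #0) (call₁ numPosᶜ #0) (call₁ denPredᶜ #0))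

    subQᶜ : Computable₂ subQ
    subQᶜ = computable₂ (call₂ addQᶜ #0 (call₁ negQᶜ #1))

    dblQᶜ : Computable₁ dblQ
    dblQᶜ = computable₁ (call₂ addQᶜ #0 #0)

    epsQᶜ : Computable₁ epsQ
    epsQᶜ = computable₁ (call₃ ratCodeᶜ (constᶜ 1) (constᶜ 0) (call₂ ∸ᶜ (call₁ pow2ᶜ #0) (constᶜ 1)))

    maxQᶜ : Computable₂ maxQ
    maxQᶜ = computable₂ (call₃ ifPosᶜ (call₂ leQᶜ #0 #1) #1 #0)

    clampQᶜ : Computable₂ clampQ
    clampQᶜ = computable₂ (call₃ ifPosᶜ (call₂ leQᶜ (call₂ maxQᶜ #0 (constᶜ 0)) #1) (call₂ maxQᶜ #0 (constᶜ 0)) #1)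

module Algorithm where

  open import Defs
  open Computability
  open Arithmetic
  open RationalCodes
  open import Data.Nat using (ℕ; zero; suc; _+_; _*_; _∸_)
  open import Data.Fin using () renaming (zero to fz; suc to fs)
  open import Data.Vec using ([]; _∷_; lookup)
  open import Relation.Binary.PropositionalEquality using (_≡_; refl; cong)

  -- allUpTo f k = f 0 * ... * f k: positive iff all of f 0, ..., f k are.
  allUpTo : (ℕ → ℕ) → ℕ → ℕ
  allUpTo f zero = f 0
  allUpTo f (suc k) = allUpTo f k * f (suc k)

  approxAt : Baire → ℕ → ℕ → ℕ
  approxAt h τ j = h (pair τ j)

  agree : Baire → ℕ → ℕ → ℕ → ℕ
  agree h τ j i = leQ (subQ (approxAt h τ j) (approxAt h τ i)) (epsQ i)
                * leQ (subQ (approxAt h τ i) (approxAt h τ j)) (epsQ i)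

  cauchyUpTo : Baire → ℕ → ℕ → ℕ
  cauchyUpTo h τ k = allUpTo (λ j → allUpTo (agree h τ j) j) k

  -- The largest k' ≤ k up to which the approximations at τ are fast-Cauchy (or 0).
  lastCauchy : Baire → ℕ → ℕ → ℕ
  lastCauchy h τ zero = 0
  lastCauchy h τ (suc k) = ifPos (cauchyUpTo h τ (suc k)) (suc k) (lastCauchy h τ k)

  -- The repaired approximations: always fast-Cauchy, and equal to h's when those are.
  repaired : Baire → ℕ → ℕ → ℕ
  repaired h τ k = approxAt h τ (lastCauchy h τ k)

  rootValue : Baire → ℕ → ℕ
  rootValue h p = maxQ (repaired h 0 p) 0

  -- Values at σ0 and σ1 from the value v at σ, where c is the code of σ0: the value at σ0
  -- is the (repaired) approximation clamped to [0, 2v], and σ1 receives the rest of 2v.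
  childValue : Baire → ℕ → ℕ → ℕ → ℕ → ℕ
  childValue h p c v b = ifPos b (subQ (dblQ v) clampChild) clampChild
    where
    clampChild : ℕ
    clampChild = clampQ (repaired h c p) (dblQ v)

  -- The value at σ is computed by walking along σ from the root, with a state coding
  -- (code of the unread rest of σ, code of the prefix π read so far, 2^|π|, value at π).
  state : ℕ → ℕ → ℕ → ℕ → ℕ
  state r e w v = pair (pair r e) (pair w v)

  rest prefix power value : ℕ → ℕ
  rest T = pairFst (pairFst T)
  prefix T = pairSnd (pairFst T)
  power T = pairFst (pairSnd T)
  value T = pairSnd (pairSnd T)

  -- The first letter and the remainder of the string coded by r > 0.
  firstBit restBits : ℕ → ℕ
  firstBit r = parity (r ∸ 1)
  restBits r = half (r ∸ 1)

  walkStep : Baire → ℕ → ℕ → ℕ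
  walkStep h p T = ifPos (rest T)
    (state (restBits (rest T)) (prefix T + suc (firstBit (rest T)) * power T) (power T + power T)
           (childValue h p (prefix T + power T) (value T) (firstBit (rest T))))
    T

  walk : Baire → ℕ → ℕ → ℕ → ℕ
  walk h p zero T = T
  walk h p (suc k) T = walkStep h p (walk h p k T)

  -- The value at precision p at the string coded by s (s steps are enough to read it).
  valueAt : Baire → ℕ → ℕ → ℕ
  valueAt h p s = value (walk h p s (state s 0 1 (rootValue h p)))

  precision : ℕ → ℕ → ℕ
  precision k s = k + 3 * s + 5

  repairedCode : Baire → Baire
  repairedCode h N = valueAt h (precision (pairSnd N) (pairFst N)) (pairFst N)

  allUpToᶜ₁ : ∀ {F : Functional 2} → Computable 2 F →
              Computable 2 (λ X xs → allUpTo (λ i → F X (i ∷ lookup xs (fs fz) ∷ [])) (lookup xs fz))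
  allUpToᶜ₁ {F} f = computable-resp (λ { X (k ∷ a ∷ []) → unfold X k a })
                                    (primRecᶜ (apply₂ f (constᶜ 0) #0) (call₂ *ᶜ #1 (apply₂ f (call₁ sucᶜ #0) #2)))
    where
    unfold : ∀ X k a → primRec (λ X xs → F X (0 ∷ lookup xs fz ∷ []))
                               (λ X xs → lookup xs (fs fz) * F X (suc (lookup xs fz) ∷ lookup xs (fs (fs fz)) ∷ [])) X (k ∷ a ∷ [])
                       ≡ allUpTo (λ i → F X (i ∷ a ∷ [])) k
    unfold X zero a = refl
    unfold X (suc k) a = cong (_* F X (suc k ∷ a ∷ [])) (unfold X k a)

  allUpToᶜ₂ : ∀ {F : Functional 3} → Computable 3 F →
              Computable 3 (λ X xs → allUpTo (λ i → F X (i ∷ lookup xs (fs fz) ∷ lookup xs (fs (fs fz)) ∷ [])) (lookup xs fz))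
  allUpToᶜ₂ {F} f = computable-resp (λ { X (k ∷ a ∷ b ∷ []) → unfold X k a b })
                                    (primRecᶜ (apply₃ f (constᶜ 0) #0 #1) (call₂ *ᶜ #1 (apply₃ f (call₁ sucᶜ #0) #2 #3)))
    where
    unfold : ∀ X k a b → primRec (λ X xs → F X (0 ∷ lookup xs fz ∷ lookup xs (fs fz) ∷ []))
                                 (λ X xs → lookup xs (fs fz) * F X (suc (lookup xs fz) ∷ lookup xs (fs (fs fz)) ∷ lookup xs (fs (fs (fs fz))) ∷ []))
                                 X (k ∷ a ∷ b ∷ [])
                         ≡ allUpTo (λ i → F X (i ∷ a ∷ b ∷ [])) k
    unfold X zero a b = refl
    unfold X (suc k) a b = cong (_* F X (suc k ∷ a ∷ b ∷ [])) (unfold X k a b)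

  stateᶜ : Computable 4 (λ _ xs → state (lookup xs fz) (lookup xs (fs fz)) (lookup xs (fs (fs fz))) (lookup xs (fs (fs (fs fz)))))
  stateᶜ = call₂ pairᶜ (call₂ pairᶜ #0 #1) (call₂ pairᶜ #2 #3)

  restᶜ : Computable₁ rest
  restᶜ = computable₁ (call₁ pairFstᶜ (call₁ pairFstᶜ #0))

  prefixᶜ : Computable₁ prefix
  prefixᶜ = computable₁ (call₁ pairSndᶜ (call₁ pairFstᶜ #0))

  powerᶜ : Computable₁ power
  powerᶜ = computable₁ (call₁ pairFstᶜ (call₁ pairSndᶜ #0))

  valueᶜ : Computable₁ value
  valueᶜ = computable₁ (call₁ pairSndᶜ (call₁ pairSndᶜ #0))

  firstBitᶜ : Computable₁ firstBit
  firstBitᶜ = computable₁ (call₁ parityᶜ (call₂ ∸ᶜ #0 (constᶜ 1)))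

  restBitsᶜ : Computable₁ restBits
  restBitsᶜ = computable₁ (call₁ halfᶜ (call₂ ∸ᶜ #0 (constᶜ 1)))

  module Uniformity (Φ : Cantor → Baire) (Φᶜ : Computable 1 (λ X xs → Φ X (lookup xs fz))) where

    -- arguments (τ ∷ j)
    approxAtᶜ : Computable 2 (λ X xs → approxAt (Φ X) (lookup xs fz) (lookup xs (fs fz)))
    approxAtᶜ = apply₁ Φᶜ (call₂ pairᶜ #0 #1)

    -- arguments (i ∷ j ∷ τ)
    agreeᶜ : Computable 3 (λ X xs → agree (Φ X) (lookup xs (fs (fs fz))) (lookup xs (fs fz)) (lookup xs fz))
    agreeᶜ = call₂ *ᶜ (call₂ leQᶜ (call₂ subQᶜ (apply₂ approxAtᶜ #2 #1) (apply₂ approxAtᶜ #2 #0)) (call₁ epsQᶜ #0))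
                      (call₂ leQᶜ (call₂ subQᶜ (apply₂ approxAtᶜ #2 #0) (apply₂ approxAtᶜ #2 #1)) (call₁ epsQᶜ #0))

    -- arguments (k ∷ τ)
    cauchyUpToᶜ : Computable 2 (λ X xs → cauchyUpTo (Φ X) (lookup xs (fs fz)) (lookup xs fz))
    cauchyUpToᶜ = allUpToᶜ₁ (apply₃ (allUpToᶜ₂ agreeᶜ) #0 #0 #1)

    -- arguments (k ∷ τ)
    lastCauchyᶜ : Computable 2 (λ X xs → lastCauchy (Φ X) (lookup xs (fs fz)) (lookup xs fz))
    lastCauchyᶜ = computable-resp (λ { X (k ∷ τ ∷ []) → unfold X k τ })
      (primRecᶜ zeroᶜ (call₃ ifPosᶜ (apply₂ cauchyUpToᶜ (call₁ sucᶜ #0) #2) (call₁ sucᶜ #0) #1))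
      where
      unfold : ∀ X k τ → primRec (λ _ _ → 0)
                                  (λ X xs → ifPos (cauchyUpTo (Φ X) (lookup xs (fs (fs fz))) (suc (lookup xs fz))) (suc (lookup xs fz)) (lookup xs (fs fz)))
                                  X (k ∷ τ ∷ [])
                         ≡ lastCauchy (Φ X) τ k
      unfold X zero τ = refl
      unfold X (suc k) τ = cong (ifPos (cauchyUpTo (Φ X) τ (suc k)) (suc k)) (unfold X k τ)

    -- arguments (τ ∷ k)
    repairedᶜ : Computable 2 (λ X xs → repaired (Φ X) (lookup xs fz) (lookup xs (fs fz)))
    repairedᶜ = apply₂ approxAtᶜ #0 (apply₂ lastCauchyᶜ #1 #0)

    -- arguments (p ∷ c ∷ v ∷ b)
    childValueᶜ : Computable 4 (λ X xs → childValue (Φ X) (lookup xs fz) (lookup xs (fs fz)) (lookup xs (fs (fs fz))) (lookup xs (fs (fs (fs fz)))))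
    childValueᶜ = call₃ ifPosᶜ #3 (call₂ subQᶜ (call₁ dblQᶜ #2) clampChildᶜ) clampChildᶜ
      where
      clampChildᶜ : Computable 4 (λ X xs → clampQ (repaired (Φ X) (lookup xs (fs fz)) (lookup xs fz)) (dblQ (lookup xs (fs (fs fz)))))
      clampChildᶜ = call₂ clampQᶜ (apply₂ repairedᶜ #1 #0) (call₁ dblQᶜ #2)

    -- arguments (p ∷ T)
    walkStepᶜ : Computable 2 (λ X xs → walkStep (Φ X) (lookup xs fz) (lookup xs (fs fz)))
    walkStepᶜ = call₃ ifPosᶜ r
      (apply₄ stateᶜ (call₁ restBitsᶜ r) (call₂ +ᶜ e (call₂ *ᶜ (call₁ sucᶜ (call₁ firstBitᶜ r)) w)) (call₂ +ᶜ w w)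
                     (apply₄ childValueᶜ #0 (call₂ +ᶜ e w) (call₁ valueᶜ #1) (call₁ firstBitᶜ r)))
      #1
      where
      r : Computable 2 (λ _ xs → rest (lookup xs (fs fz)))
      r = call₁ restᶜ #1
      e : Computable 2 (λ _ xs → prefix (lookup xs (fs fz)))
      e = call₁ prefixᶜ #1
      w : Computable 2 (λ _ xs → power (lookup xs (fs fz)))
      w = call₁ powerᶜ #1

    -- arguments (k ∷ p ∷ T)
    walkᶜ : Computable 3 (λ X xs → walk (Φ X) (lookup xs (fs fz)) (lookup xs fz) (lookup xs (fs (fs fz))))
    walkᶜ = computable-resp (λ { X (k ∷ p ∷ T ∷ []) → unfold X k p T }) (primRecᶜ #1 (apply₂ walkStepᶜ #2 #1))
      where
      unfold : ∀ X k p T → primRec (λ _ xs → lookup xs (fs fz)) (λ X xs → walkStep (Φ X) (lookup xs (fs (fs fz))) (lookup xs (fs fz)))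
                                   X (k ∷ p ∷ T ∷ [])
                           ≡ walk (Φ X) p k T
      unfold X zero p T = refl
      unfold X (suc k) p T = cong (walkStep (Φ X) p) (unfold X k p T)

    -- arguments (p ∷ s)
    valueAtᶜ : Computable 2 (λ X xs → valueAt (Φ X) (lookup xs fz) (lookup xs (fs fz)))
    valueAtᶜ = call₁ valueᶜ (apply₃ walkᶜ #1 #0 (apply₄ stateᶜ #1 (constᶜ 0) (constᶜ 1)
                                                         (call₂ maxQᶜ (apply₂ repairedᶜ (constᶜ 0) #0) (constᶜ 0))))

    repairedCodeᶜ : TotalComputable (λ X → repairedCode (Φ X))
    repairedCodeᶜ = computable⇒total (apply₂ valueAtᶜ (call₂ +ᶜ (call₂ +ᶜ (call₁ pairSndᶜ #0) (call₂ *ᶜ (constᶜ 3) (call₁ pairFstᶜ #0))) (constᶜ 5))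
                                                      (call₁ pairFstᶜ #0))

module CauchyRepair where

  open import Defs
  open Arithmetic
  open RationalCodes
  open Algorithm
  open Precision
  open Closeness
  open import Data.Nat using (ℕ; zero; suc; _*_; _≤_; z≤n; s≤s; _≟_)
  open import Data.Nat.Properties using (≤-refl; ≤-trans; m≤n⇒m≤1+n; m≤n⇒m<n∨m≡n; m*n≡0⇒m≡0∨n≡0; *-zeroʳ)
  open import Data.Product using (_×_; _,_; proj₁; proj₂)
  open import Data.Sum using (inj₁; inj₂)
  open import Data.Empty using (⊥-elim)
  open import Relation.Nullary using (yes; no)
  open import Relation.Binary.PropositionalEquality
  open import Data.Rational.Unnormalised using (ℚᵘ; _-_) renaming (_≤_ to _≤ℚ_)
  open import Data.Rational.Unnormalised.Properties using (≤-respˡ-≃; ≃-sym)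

  *≢0⇒factors≢0 : ∀ m n → m * n ≢ 0 → m ≢ 0 × n ≢ 0
  *≢0⇒factors≢0 zero n h = ⊥-elim (h refl)
  *≢0⇒factors≢0 (suc m) zero h = ⊥-elim (h (*-zeroʳ m))
  *≢0⇒factors≢0 (suc m) (suc n) h = (λ ()) , (λ ())

  allUpTo-sound : ∀ f k → allUpTo f k ≢ 0 → ∀ j → j ≤ k → f j ≢ 0
  allUpTo-sound f zero h .zero z≤n = h
  allUpTo-sound f (suc k) h j j≤k with m≤n⇒m<n∨m≡n j≤k
  ... | inj₂ refl = proj₂ (*≢0⇒factors≢0 (allUpTo f k) (f (suc k)) h)
  ... | inj₁ (s≤s j≤k') = allUpTo-sound f k (proj₁ (*≢0⇒factors≢0 (allUpTo f k) (f (suc k)) h)) j j≤k'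

  allUpTo-complete : ∀ f k → (∀ j → j ≤ k → f j ≢ 0) → allUpTo f k ≢ 0
  allUpTo-complete f zero h = h 0 z≤n
  allUpTo-complete f (suc k) h e with m*n≡0⇒m≡0∨n≡0 (allUpTo f k) e
  ... | inj₁ e₁ = allUpTo-complete f k (λ j j≤k → h j (m≤n⇒m≤1+n j≤k)) e₁
  ... | inj₂ e₂ = h (suc k) ≤-refl e₂

  diff≤ε-sound : ∀ a b i → leQ (subQ a b) (epsQ i) ≢ 0 → ⟦ a ⟧ - ⟦ b ⟧ ≤ℚ ε i
  diff≤ε-sound a b i ok = subst (⟦ a ⟧ - ⟦ b ⟧ ≤ℚ_) (epsQ-sem i) (≤-respˡ-≃ (subQ-sem a b) (leQ-sound (subQ a b) (epsQ i) ok))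

  diff≤ε-complete : ∀ a b i → ⟦ a ⟧ - ⟦ b ⟧ ≤ℚ ε i → leQ (subQ a b) (epsQ i) ≡ 1
  diff≤ε-complete a b i p = leQ-complete (subQ a b) (epsQ i) (subst (⟦ subQ a b ⟧ ≤ℚ_) (sym (epsQ-sem i)) (≤-respˡ-≃ (≃-sym (subQ-sem a b)) p))

  module _ (h : Baire) where

    proposed : ℕ → ℕ → ℚᵘ
    proposed τ j = ⟦ approxAt h τ j ⟧

    FastCauchyAt : ℕ → Set
    FastCauchyAt τ = ∀ j i → i ≤ j → Close (ε i) (proposed τ j) (proposed τ i)

    agree-sound : ∀ τ j i → agree h τ j i ≢ 0 → Close (ε i) (proposed τ j) (proposed τ i)
    agree-sound τ j i ok with *≢0⇒factors≢0 _ _ ok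
    ... | ok₁ , ok₂ = close (diff≤ε-sound (approxAt h τ j) (approxAt h τ i) i ok₁) (diff≤ε-sound (approxAt h τ i) (approxAt h τ j) i ok₂)

    agree-complete : ∀ τ j i → Close (ε i) (proposed τ j) (proposed τ i) → agree h τ j i ≢ 0
    agree-complete τ j i (close lo hi) rewrite diff≤ε-complete (approxAt h τ j) (approxAt h τ i) i lo
                                          | diff≤ε-complete (approxAt h τ i) (approxAt h τ j) i hi = λ ()

    cauchyUpTo-sound : ∀ τ k → cauchyUpTo h τ k ≢ 0 → ∀ j i → i ≤ j → j ≤ k → Close (ε i) (proposed τ j) (proposed τ i)
    cauchyUpTo-sound τ k ok j i i≤j j≤k =
      agree-sound τ j i (allUpTo-sound (agree h τ j) j (allUpTo-sound _ k ok j j≤k) i i≤j)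

    cauchyUpTo-mono : ∀ τ k m → cauchyUpTo h τ k ≢ 0 → m ≤ k → cauchyUpTo h τ m ≢ 0
    cauchyUpTo-mono τ k m ok m≤k = allUpTo-complete _ m (λ j j≤m → allUpTo-sound _ k ok j (≤-trans j≤m m≤k))

    cauchyUpTo-complete : ∀ τ → FastCauchyAt τ → ∀ k → cauchyUpTo h τ k ≢ 0
    cauchyUpTo-complete τ fc k =
      allUpTo-complete _ k (λ j _ → allUpTo-complete _ j (λ i i≤j → agree-complete τ j i (fc j i i≤j)))

    lastCauchy-good : ∀ τ k → cauchyUpTo h τ k ≢ 0 → lastCauchy h τ k ≡ k
    lastCauchy-good τ zero ok = refl
    lastCauchy-good τ (suc k) ok with cauchyUpTo h τ (suc k)
    ... | zero = ⊥-elim (ok refl)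
    ... | suc _ = refl

    lastCauchy-bad : ∀ τ k → cauchyUpTo h τ (suc k) ≡ 0 → lastCauchy h τ (suc k) ≡ lastCauchy h τ k
    lastCauchy-bad τ k bad rewrite bad = refl

    repaired-fastCauchy : ∀ τ k m → m ≤ k → Close (ε m) ⟦ repaired h τ k ⟧ ⟦ repaired h τ m ⟧
    repaired-fastCauchy τ zero .zero z≤n = close-refl _ (ε-nonneg 0)
    repaired-fastCauchy τ (suc k) m m≤k with m≤n⇒m<n∨m≡n m≤k
    ... | inj₂ refl = close-refl _ (ε-nonneg (suc k))
    ... | inj₁ (s≤s m≤k') with cauchyUpTo h τ (suc k) ≟ 0
    ...   | yes bad rewrite lastCauchy-bad τ k bad = repaired-fastCauchy τ k m m≤k'
    ...   | no ok rewrite lastCauchy-good τ (suc k) ok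
                        | lastCauchy-good τ m (cauchyUpTo-mono τ (suc k) m ok (m≤n⇒m≤1+n m≤k')) =
              cauchyUpTo-sound τ (suc k) ok (suc k) m (m≤n⇒m≤1+n m≤k') ≤-refl

    repaired-good : ∀ τ → FastCauchyAt τ → ∀ k → repaired h τ k ≡ approxAt h τ k
    repaired-good τ fc k = cong (approxAt h τ) (lastCauchy-good τ k (cauchyUpTo-complete τ fc k))

module StringWalk where

  open import Defs
  open Arithmetic
  open Algorithm
  open import Data.Nat using (ℕ; zero; suc; _+_; _*_; _^_; _≤_; z≤n; s≤s)
  open import Data.Nat.Properties
    using (+-identityʳ; *-identityʳ; +-comm; ≤-trans; m≤m+n; m≤n+m; +-monoˡ-≤; +-monoʳ-≤; +-mono-≤; *-monoʳ-≤; *-monoˡ-≤)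
  open import Data.Nat.Solver using (module +-*-Solver)
  open import Data.Bool using (Bool; false; true)
  open import Data.List using ([]; _∷_; _∷ʳ_; _++_; length)
  open import Data.List.Properties using (∷ʳ-++; length-++; ++-identityʳ)
  open import Relation.Binary.PropositionalEquality
  open +-*-Solver

  -- A string b ∷ σ has code 1 + b + 2·code(σ), so its first letter and rest are read off by parity and halving.
  encStr-cons : ∀ b σ → encStr (b ∷ σ) ≡ suc (bit b + (encStr σ + encStr σ))
  encStr-cons false σ = cong suc (cong (encStr σ +_) (+-identityʳ (encStr σ)))
  encStr-cons true σ = cong (λ n → suc (suc n)) (cong (encStr σ +_) (+-identityʳ (encStr σ)))

  firstBit-cons : ∀ b σ → firstBit (encStr (b ∷ σ)) ≡ bit b
  firstBit-cons b σ rewrite encStr-cons b σ with b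
  ... | false = parity-even (encStr σ)
  ... | true rewrite parity-even (encStr σ) = refl

  restBits-cons : ∀ b σ → restBits (encStr (b ∷ σ)) ≡ encStr σ
  restBits-cons b σ rewrite encStr-cons b σ with b
  ... | false = half-even (encStr σ)
  ... | true rewrite half-even (encStr σ) | parity-even (encStr σ) = +-identityʳ (encStr σ)

  length≤encStr : ∀ σ → length σ ≤ encStr σ
  length≤encStr [] = z≤n
  length≤encStr (b ∷ σ) rewrite encStr-cons b σ =
    s≤s (≤-trans (length≤encStr σ) (≤-trans (m≤m+n _ _) (m≤n+m _ (bit b))))

  encStr-snoc : ∀ σ b → encStr (σ ∷ʳ b) ≡ encStr σ + suc (bit b) * 2 ^ length σ
  encStr-snoc [] b rewrite *-identityʳ (suc (bit b)) = trans (encStr-cons b []) (cong suc (+-identityʳ (bit b)))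
  encStr-snoc (b' ∷ σ) b rewrite encStr-cons b' (σ ∷ʳ b) | encStr-cons b' σ | encStr-snoc σ b =
    cong suc (solve 4 (λ c e d p → c :+ ((e :+ d :* p) :+ (e :+ d :* p)) := c :+ (e :+ e) :+ d :* (con 2 :* p))
                      refl (bit b') (encStr σ) (suc (bit b)) (2 ^ length σ))

  length-snoc : ∀ σ (b : Bool) → length (σ ∷ʳ b) ≡ suc (length σ)
  length-snoc σ b = trans (length-++ σ) (+-comm (length σ) 1)

  power-snoc : ∀ σ (b : Bool) → 2 ^ length (σ ∷ʳ b) ≡ 2 ^ length σ + 2 ^ length σ
  power-snoc σ b = trans (cong (2 ^_) (length-snoc σ b)) (cong (2 ^ length σ +_) (+-identityʳ (2 ^ length σ)))

  walkFrom : Baire → ℕ → Str → ℕ → Str → ℕ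
  walkFrom h p π v [] = v
  walkFrom h p π v (b ∷ σ) = walkFrom h p (π ∷ʳ b) (childValue h p (encStr (π ∷ʳ false)) v (bit b)) σ

  valueOf : Baire → ℕ → Str → ℕ
  valueOf h p σ = walkFrom h p [] (rootValue h p) σ

  rest-state : ∀ r e w v → rest (state r e w v) ≡ r
  rest-state r e w v rewrite pairFst-pair (pair r e) (pair w v) = pairFst-pair r e

  prefix-state : ∀ r e w v → prefix (state r e w v) ≡ e
  prefix-state r e w v rewrite pairFst-pair (pair r e) (pair w v) = pairSnd-pair r e

  power-state : ∀ r e w v → power (state r e w v) ≡ w
  power-state r e w v rewrite pairSnd-pair (pair r e) (pair w v) = pairFst-pair w v

  value-state : ∀ r e w v → value (state r e w v) ≡ v
  value-state r e w v rewrite pairSnd-pair (pair r e) (pair w v) = pairSnd-pair w v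

  walkStep-done : ∀ h p T → rest T ≡ 0 → walkStep h p T ≡ T
  walkStep-done h p T e rewrite e = refl

  walkStep-cons : ∀ h p b σ π v →
    walkStep h p (state (encStr (b ∷ σ)) (encStr π) (2 ^ length π) v)
    ≡ state (encStr σ) (encStr (π ∷ʳ b)) (2 ^ length (π ∷ʳ b)) (childValue h p (encStr (π ∷ʳ false)) v (bit b))
  walkStep-cons h p b σ π v
    rewrite rest-state (encStr (b ∷ σ)) (encStr π) (2 ^ length π) v
          | prefix-state (encStr (b ∷ σ)) (encStr π) (2 ^ length π) v
          | power-state (encStr (b ∷ σ)) (encStr π) (2 ^ length π) v
          | value-state (encStr (b ∷ σ)) (encStr π) (2 ^ length π) v
          | firstBit-cons b σ | restBits-cons b σ | encStr-cons b σ
          | encStr-snoc π b | encStr-snoc π false | +-identityʳ (2 ^ length π) =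
    cong (λ w → state (encStr σ) (encStr π + suc (bit b) * 2 ^ length π) w (childValue h p (encStr π + 2 ^ length π) v (bit b)))
         (sym (power-snoc π b))

  walk-suc : ∀ h p k T → walk h p (suc k) T ≡ walk h p k (walkStep h p T)
  walk-suc h p zero T = refl
  walk-suc h p (suc k) T = cong (walkStep h p) (walk-suc h p k T)

  walk-done : ∀ h p k T → walkStep h p T ≡ T → walk h p k T ≡ T
  walk-done h p zero T e = refl
  walk-done h p (suc k) T e rewrite walk-done h p k T e = e

  walk-correct : ∀ h p σ k π v → length σ ≤ k →
    value (walk h p k (state (encStr σ) (encStr π) (2 ^ length π) v)) ≡ walkFrom h p π v σ
  walk-correct h p [] k π v _
    rewrite walk-done h p k (state 0 (encStr π) (2 ^ length π) v)
                      (walkStep-done h p _ (rest-state 0 (encStr π) (2 ^ length π) v)) =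
    value-state 0 (encStr π) (2 ^ length π) v
  walk-correct h p (b ∷ σ) (suc k) π v (s≤s |σ|≤k)
    rewrite walk-suc h p k (state (encStr (b ∷ σ)) (encStr π) (2 ^ length π) v) | walkStep-cons h p b σ π v =
    walk-correct h p σ k (π ∷ʳ b) _ |σ|≤k

  valueAt-correct : ∀ h p σ → valueAt h p (encStr σ) ≡ valueOf h p σ
  valueAt-correct h p σ = walk-correct h p σ (encStr σ) [] (rootValue h p) (length≤encStr σ)

  repairedCode-correct : ∀ h σ k → repairedCode h (pair (encStr σ) k) ≡ valueOf h (precision k (encStr σ)) σ
  repairedCode-correct h σ k rewrite pairFst-pair (encStr σ) k | pairSnd-pair (encStr σ) k =
    valueAt-correct h (precision k (encStr σ)) σ

  walkFrom-snoc : ∀ h p π v σ b →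
    walkFrom h p π v (σ ∷ʳ b) ≡ childValue h p (encStr ((π ++ σ) ∷ʳ false)) (walkFrom h p π v σ) (bit b)
  walkFrom-snoc h p π v [] b rewrite ++-identityʳ π = refl
  walkFrom-snoc h p π v (b' ∷ σ) b rewrite walkFrom-snoc h p (π ∷ʳ b') (childValue h p (encStr (π ∷ʳ false)) v (bit b')) σ b
                                         | ∷ʳ-++ π b' σ = refl

  valueOf-snoc : ∀ h p σ b → valueOf h p (σ ∷ʳ b) ≡ childValue h p (encStr (σ ∷ʳ false)) (valueOf h p σ) (bit b)
  valueOf-snoc h p σ b = walkFrom-snoc h p [] (rootValue h p) σ b

  precision-bound⁺ : ∀ k σ → k + 3 * length σ + 5 ≤ precision k (encStr σ)
  precision-bound⁺ k σ = +-monoˡ-≤ 5 (+-monoʳ-≤ k (*-monoʳ-≤ 3 (length≤encStr σ)))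

  precision-bound : ∀ k σ → k + 3 * length σ ≤ precision k (encStr σ)
  precision-bound k σ = ≤-trans (m≤m+n _ 5) (precision-bound⁺ k σ)

  precision-mono : ∀ {m k} s t → m ≤ k → s ≤ t → precision m s ≤ precision k t
  precision-mono s t m≤k s≤t = +-monoˡ-≤ 5 (+-mono-≤ m≤k (*-monoʳ-≤ 3 s≤t))

  encStr-parent≤ : ∀ σ → encStr σ ≤ encStr (σ ∷ʳ false)
  encStr-parent≤ σ rewrite encStr-snoc σ false = m≤m+n (encStr σ) _

  encStr-sibling≤ : ∀ σ → encStr (σ ∷ʳ false) ≤ encStr (σ ∷ʳ true)
  encStr-sibling≤ σ rewrite encStr-snoc σ false | encStr-snoc σ true =
    +-monoʳ-≤ (encStr σ) (*-monoˡ-≤ (2 ^ length σ) {1} {2} (s≤s z≤n))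

  length-sibling : ∀ σ → length (σ ∷ʳ false) ≡ length (σ ∷ʳ true)
  length-sibling σ = trans (length-snoc σ false) (sym (length-snoc σ true))

module Analysis where

  open import Defs
  open RationalCodes
  open Algorithm
  open StringWalk
  open CauchyRepair
  open Precision
  open Closeness
  open Clamping
  open import Data.Nat as ℕ using (ℕ; _≤_)
  import Data.Nat.Properties as ℕP
  open import Data.Nat.Solver using () renaming (module +-*-Solver to ℕ-Solver)
  open import Data.Bool using (Bool; true; false)
  open import Data.List using ([]; _∷ʳ_; length)
  open import Data.List.Reverse using (Reverse; reverseView; []; _∶_∶ʳ_)
  open import Data.Product using (_,_; proj₁; proj₂)
  open import Relation.Binary.PropositionalEquality
  open import Data.Rational.Unnormalised as ℚ using (ℚᵘ; 1ℚᵘ; _≃_; _+_; _-_; 0ℚᵘ)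
  open import Data.Rational.Unnormalised.Properties
    using (≃-refl; ≃-sym; ≃-trans; ≤-trans; ≤-reflexive; ≤-respʳ-≃; +-congˡ; +-congʳ; p≤q⇒0≤q-p)
  open import Data.Rational.Unnormalised.Solver using () renaming (module +-*-Solver to ℚ-Solver)

  snoc-induction : (P : Str → Set) → P [] → (∀ σ b → P σ → P (σ ∷ʳ b)) → ∀ σ → P σ
  snoc-induction P base step σ = go σ (reverseView σ)
    where
    go : ∀ σ → Reverse σ → P σ
    go .[] [] = base
    go .(σ ∷ʳ b) (σ ∶ r ∶ʳ b) = step σ b (go σ r)

  -- The hypothesis j + 3|σb| ≤ p is the hypothesis (3 + j) + 3|σ| ≤ p of the parent.
  parent-precision : ∀ j σ (b : Bool) → j ℕ.+ 3 ℕ.* length (σ ∷ʳ b) ≡ (3 ℕ.+ j) ℕ.+ 3 ℕ.* length σ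
  parent-precision j σ b = trans (cong (λ n → j ℕ.+ 3 ℕ.* n) (length-snoc σ b))
                                 (solve 2 (λ j n → j :+ con 3 :* (con 1 :+ n) := (con 3 :+ j) :+ con 3 :* n) refl j (length σ))
    where open ℕ-Solver

  module NewMartingale (h : Baire) where

    Y : ℕ → ℕ → ℚᵘ
    Y p τ = ⟦ repaired h τ p ⟧

    W : ℕ → Str → ℚᵘ
    W p σ = ⟦ valueOf h p σ ⟧

    W-root : ∀ p → MaxSel (W p []) (Y p 0) 0ℚᵘ
    W-root p = maxQ-sel (repaired h 0 p) 0

    W-false : ∀ p σ → Clamp (W p (σ ∷ʳ false)) (Y p (encStr (σ ∷ʳ false))) (W p σ + W p σ)
    W-false p σ rewrite valueOf-snoc h p σ false with clampQ-sel (repaired h (encStr (σ ∷ʳ false)) p) (dblQ (valueOf h p σ))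
    ... | m , max , min = m , max , minSel-resp (dblQ-sem (valueOf h p σ)) min

    W-true : ∀ p σ → W p (σ ∷ʳ true) ≃ (W p σ + W p σ) - W p (σ ∷ʳ false)
    W-true p σ rewrite valueOf-snoc h p σ true | valueOf-snoc h p σ false =
      ≃-trans (subQ-sem (dblQ v) c) (+-congˡ (ℚ.- ⟦ c ⟧) (dblQ-sem v))
      where
      v c : ℕ
      v = valueOf h p σ
      c = clampQ (repaired h (encStr (σ ∷ʳ false)) p) (dblQ v)

    W-nonneg : ∀ p σ → NonNeg (W p σ)
    W-nonneg p = snoc-induction (λ σ → NonNeg (W p σ)) (max0-nonneg (W-root p)) step
      where
      step : ∀ σ b → NonNeg (W p σ) → NonNeg (W p (σ ∷ʳ b))
      step σ false ih = proj₁ (clamp-bounds (nonneg-+ ih ih) (W-false p σ))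
      step σ true ih = ≤-respʳ-≃ (≃-sym (W-true p σ)) (p≤q⇒0≤q-p (proj₂ (clamp-bounds (nonneg-+ ih ih) (W-false p σ))))

    W-martingale : ∀ p σ → W p (σ ∷ʳ false) + W p (σ ∷ʳ true) ≃ W p σ + W p σ
    W-martingale p σ = ≃-trans (+-congʳ (W p (σ ∷ʳ false)) (W-true p σ)) (cancel (W p (σ ∷ʳ false)) (W p σ))
      where
      open ℚ-Solver
      cancel : ∀ c w → c + ((w + w) - c) ≃ w + w
      cancel = solve 2 (λ c w → c :+ ((w :+ w) :- c) := w :+ w) ≃-refl

    Y-cauchy : ∀ τ j p p' → j ≤ p → p ≤ p' → Close (ε j) (Y p τ) (Y p' τ)
    Y-cauchy τ j p p' j≤p p≤p' = close-mono (ε-anti j≤p) (close-sym (repaired-fastCauchy h τ p' p p≤p'))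

    W-cauchy : ∀ σ j p p' → j ℕ.+ 3 ℕ.* length σ ≤ p → p ≤ p' → Close (ε j) (W p σ) (W p' σ)
    W-cauchy = snoc-induction (λ σ → ∀ j p p' → j ℕ.+ 3 ℕ.* length σ ≤ p → p ≤ p' → Close (ε j) (W p σ) (W p' σ)) base step
      where
      base : ∀ j p p' → j ℕ.+ 0 ≤ p → p ≤ p' → Close (ε j) (W p []) (W p' [])
      base j p p' j≤p p≤p' = close-max (Y-cauchy 0 j p p' (subst (_≤ p) (ℕP.+-identityʳ j) j≤p) p≤p')
                                       (close-refl 0ℚᵘ (ε-nonneg j)) (W-root p) (W-root p')
      step : ∀ σ b → (∀ j p p' → j ℕ.+ 3 ℕ.* length σ ≤ p → p ≤ p' → Close (ε j) (W p σ) (W p' σ)) →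
             ∀ j p p' → j ℕ.+ 3 ℕ.* length (σ ∷ʳ b) ≤ p → p ≤ p' → Close (ε j) (W p (σ ∷ʳ b)) (W p' (σ ∷ʳ b))
      step σ b ih j p p' j≤p p≤p' = child b
        where
        open Budget j
        e : ℚᵘ
        e = ε (3 ℕ.+ j)
        j'≤p : (3 ℕ.+ j) ℕ.+ 3 ℕ.* length σ ≤ p
        j'≤p = subst (_≤ p) (parent-precision j σ b) j≤p
        parent : Close (e + e) (W p σ + W p σ) (W p' σ + W p' σ)
        parent = close-add (ih (3 ℕ.+ j) p p' j'≤p p≤p') (ih (3 ℕ.+ j) p p' j'≤p p≤p')
        approximation : Close (e + e) (Y p (encStr (σ ∷ʳ false))) (Y p' (encStr (σ ∷ʳ false)))
        approximation = close-mono (≤-plusʳ (ε-nonneg (3 ℕ.+ j)))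
                                   (Y-cauchy _ (3 ℕ.+ j) p p' (ℕP.≤-trans (ℕP.m≤m+n (3 ℕ.+ j) _) j'≤p) p≤p')
        left : Close (e + e) (W p (σ ∷ʳ false)) (W p' (σ ∷ʳ false))
        left = clamp-close (nonneg-+ (ε-nonneg (3 ℕ.+ j)) (ε-nonneg (3 ℕ.+ j))) approximation parent (W-false p σ) (W-false p' σ)
        child : ∀ b → Close (ε j) (W p (σ ∷ʳ b)) (W p' (σ ∷ʳ b))
        child false = close-mono two-errors≤ left
        child true = close-mono four-errors≤ (close-resp (≃-sym (W-true p σ)) (≃-sym (W-true p' σ)) (close-sub parent left))

  module Agreement (h : Baire) (h-martingale : IsMartingaleCode h) where

    open NewMartingale h

    private
      G : Str → ℕ → ℚᵘ
      G σ p = approx h σ p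

    repaired-agrees : ∀ σ p → Y p (encStr σ) ≡ G σ p
    repaired-agrees σ p = cong ⟦_⟧ (repaired-good h (encStr σ) fastCauchy p)
      where
      fastCauchy : FastCauchyAt h (encStr σ)
      fastCauchy j i i≤j = abs⇒close (proj₁ h-martingale σ i j i≤j)

    defect : ∀ σ p → Close ((ε p + ε p) + (ε p + ε p)) (G (σ ∷ʳ false) p + G (σ ∷ʳ true) p) (G σ p + G σ p)
    defect σ p = close-mono (≤-reflexive (four-copies (ε p)))
                            (close-resp ≃-refl (twice (G σ p)) (abs⇒close (proj₂ (proj₂ h-martingale) σ p)))
      where
      open ℚ-Solver
      twice : ∀ x → (1ℚᵘ + 1ℚᵘ) ℚ.* x ≃ x + x
      twice = solve 1 (λ x → (con 1ℚᵘ :+ con 1ℚᵘ) :* x := x :+ x) ≃-refl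

    W-agrees : ∀ σ j p → j ℕ.+ 3 ℕ.* length σ ℕ.+ 5 ≤ p → Close (ε j) (W p σ) (G σ p)
    W-agrees = snoc-induction (λ σ → ∀ j p → j ℕ.+ 3 ℕ.* length σ ℕ.+ 5 ≤ p → Close (ε j) (W p σ) (G σ p)) base step
      where
      base : ∀ j p → j ℕ.+ 0 ℕ.+ 5 ≤ p → Close (ε j) (W p []) (G [] p)
      base j p j≤p = close-mono (ε-anti (ℕP.≤-trans (ℕP.m≤m+n j _) (ℕP.≤-trans (ℕP.m≤m+n (j ℕ.+ 0) 5) j≤p)))
                                (max0-near (subst (λ y → MaxSel (W p []) y 0ℚᵘ) (repaired-agrees [] p) (W-root p))
                                           (proj₁ (proj₂ h-martingale) [] p) (ε-nonneg p))
      step : ∀ σ b → (∀ j p → j ℕ.+ 3 ℕ.* length σ ℕ.+ 5 ≤ p → Close (ε j) (W p σ) (G σ p)) →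
             ∀ j p → j ℕ.+ 3 ℕ.* length (σ ∷ʳ b) ℕ.+ 5 ≤ p → Close (ε j) (W p (σ ∷ʳ b)) (G (σ ∷ʳ b) p)
      step σ b ih j p j≤p = child b
        where
        open Budget j
        -- e bounds the error inherited from σ, q the martingale defect and δ the negativity of h.
        e δ q : ℚᵘ
        e = ε (3 ℕ.+ j)
        δ = ε p
        q = (δ + δ) + (δ + δ)
        j'≤p : (3 ℕ.+ j) ℕ.+ 3 ℕ.* length σ ℕ.+ 5 ≤ p
        j'≤p = subst (λ n → n ℕ.+ 5 ≤ p) (parent-precision j σ b) j≤p
        5+j≤p : 5 ℕ.+ j ≤ p
        5+j≤p = ℕP.≤-trans (subst (_≤ (3 ℕ.+ j) ℕ.+ 3 ℕ.* length σ ℕ.+ 5) (ℕP.+-comm (3 ℕ.+ j) 2)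
                                   (ℕP.+-mono-≤ (ℕP.m≤m+n (3 ℕ.+ j) _) (ℕP.m≤m+n 2 3))) j'≤p
        δ≤e : δ ℚ.≤ e
        δ≤e = ε-anti (ℕP.≤-trans (ℕP.n≤1+n _) (ℕP.≤-trans (ℕP.n≤1+n _) 5+j≤p))
        q≤e : q ℚ.≤ e
        q≤e = four-ε≤ (3 ℕ.+ j) p 5+j≤p
        parent : Close e (W p σ) (G σ p)
        parent = ih (3 ℕ.+ j) p j'≤p
        clamped : Clamp (W p (σ ∷ʳ false)) (G (σ ∷ʳ false) p) (W p σ + W p σ)
        clamped = subst (λ y → Clamp (W p (σ ∷ʳ false)) y (W p σ + W p σ)) (repaired-agrees (σ ∷ʳ false) p) (W-false p σ)
        -- Clamping moves h's value at σ0 by at most its excess over 2·W(σ).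
        left : Close ((e + e) + (q + δ)) (W p (σ ∷ʳ false)) (G (σ ∷ʳ false) p)
        left = clamp-near clamped (proj₁ (proj₂ h-martingale) (σ ∷ʳ false) p) (ε-nonneg p) δ≤budget
                 (excess-bound {x = G (σ ∷ʳ false) p} {G (σ ∷ʳ true) p} {G σ p} {W p σ}
                               (defect σ p) (proj₁ (proj₂ h-martingale) (σ ∷ʳ true) p) parent)
          where
          q-nonneg : NonNeg q
          q-nonneg = nonneg-+ (nonneg-+ (ε-nonneg p) (ε-nonneg p)) (nonneg-+ (ε-nonneg p) (ε-nonneg p))
          δ≤budget : δ ℚ.≤ (e + e) + (q + δ)
          δ≤budget = ≤-trans (≤-plusˡ q-nonneg) (≤-plusˡ (nonneg-+ (ε-nonneg (3 ℕ.+ j)) (ε-nonneg (3 ℕ.+ j))))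
        -- W(σ1) = 2W(σ) - W(σ0) and h's value at σ1 is close to 2·h(σ) - h(σ0).
        right : Close (((e + e) + ((e + e) + (q + δ))) + q) (W p (σ ∷ʳ true)) (G (σ ∷ʳ true) p)
        right = close-resp (≃-sym (W-true p σ)) ≃-refl
                  (close-trans (close-sub (close-add parent parent) left)
                               (close-solve {a = G (σ ∷ʳ false) p} {G (σ ∷ʳ true) p} (defect σ p)))
        child : ∀ b → Close (ε j) (W p (σ ∷ʳ b)) (G (σ ∷ʳ b) p)
        child false = close-mono (three-errors≤ q≤e δ≤e) left
        child true = close-mono (seven-errors≤ q≤e δ≤e) right

open Computability
open RationalCodes
open Algorithm
open StringWalk
open Precision
open Closeness
open Analysis
import Data.Nat as ℕ
import Data.Nat.Properties as ℕP
open import Data.Bool using (false; true)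
open import Data.List using (_∷ʳ_; length)
open import Data.Product using (_,_; proj₁)
open import Relation.Binary.PropositionalEquality using (refl; sym; trans; cong; subst; subst₂)
open import Data.Integer using (+_)
open import Function using (_$_)
open import Data.Rational.Unnormalised using (ℚᵘ; mkℚᵘ; 1ℚᵘ; _≃_; _≤_; _+_; _-_; _*_; -_; ∣_∣)
open import Data.Rational.Unnormalised.Properties using (≃-refl; ≃-sym; ≤-refl; ≤-trans; ≤-reflexive; ≤-respʳ-≃; +-mono-≤; neg-mono-≤)
open import Data.Rational.Unnormalised.Solver using (module +-*-Solver)

MartingaleCondition : ℚᵘ → ℚᵘ → ℚᵘ → ℚᵘ → Set
MartingaleCondition t a₀ a₁ a = ∣ (a₀ + a₁) - (1ℚᵘ + 1ℚᵘ) * a ∣ ≤ t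

martingaleCondition-resp : ∀ {t a₀ a₁ a b₀ b₁ b} → a₀ ≡ b₀ → a₁ ≡ b₁ → a ≡ b →
                           MartingaleCondition t b₀ b₁ b → MartingaleCondition t a₀ a₁ a
martingaleCondition-resp refl refl refl m = m

approx-cong : ∀ {g h} → (∀ n → g n ≡ h n) → ∀ σ k → approx g σ k ≡ approx h σ k
approx-cong g≗h σ k = cong decodeℚ (g≗h _)

isMartingaleCode-resp : ∀ {g h} → (∀ n → g n ≡ h n) → IsMartingaleCode g → IsMartingaleCode h
isMartingaleCode-resp {g} {h} g≗h (fastCauchy , nonneg , martingale) =
  (λ σ m k m≤k → subst₂ (λ a b → ∣ a - b ∣ ≤ ε m) (same σ k) (same σ m) (fastCauchy σ m k m≤k)) ,
  (λ σ k → subst (- ε k ≤_) (same σ k) (nonneg σ k)) ,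
  (λ σ k → martingaleCondition-resp (sym (same (σ ∷ʳ false) k)) (sym (same (σ ∷ʳ true) k)) (sym (same σ k)) (martingale σ k))
  where
  same : ∀ σ k → approx g σ k ≡ approx h σ k
  same = approx-cong g≗h

sameMartingale-resp : ∀ {c g h} → (∀ n → g n ≡ h n) → SameMartingale c g → SameMartingale c h
sameMartingale-resp {c} g≗h same σ k = subst (λ b → ∣ approx c σ k - b ∣ ≤ mkℚᵘ (+ 2) 0 * ε k) (approx-cong g≗h σ k) (same σ k)

module Output (h : Baire) where

  open NewMartingale h

  approx-output : ∀ σ k → approx (repairedCode h) σ k ≡ W (precision k (encStr σ)) σ
  approx-output σ k = cong decodeℚ (repairedCode-correct h σ k)

  fastCauchy : FastCauchyCode (repairedCode h)
  fastCauchy σ m k m≤k =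
    subst₂ (λ a b → ∣ a - b ∣ ≤ ε m) (sym (approx-output σ k)) (sym (approx-output σ m))
      (close⇒abs (close-sym (W-cauchy σ m _ _ (precision-bound m σ) (precision-mono (encStr σ) (encStr σ) m≤k ℕP.≤-refl))))

  nonneg : ∀ σ k → - ε k ≤ approx (repairedCode h) σ k
  nonneg σ k = subst (- ε k ≤_) (sym (approx-output σ k)) (≤-trans (neg-mono-≤ (ε-nonneg k)) (W-nonneg _ σ))

  -- The three values involved are compared at the precision P₀ of σ0, where W is exactly a martingale.
  martingale : ∀ σ k → MartingaleCondition (mkℚᵘ (+ 4) 0 * ε k) (approx (repairedCode h) (σ ∷ʳ false) k)
                                           (approx (repairedCode h) (σ ∷ʳ true) k) (approx (repairedCode h) σ k)
  martingale σ k =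
    martingaleCondition-resp (approx-output (σ ∷ʳ false) k) (approx-output (σ ∷ʳ true) k) (approx-output σ k) $
    close⇒abs (close-mono budget (close-resp ≃-refl (twice (W P σ)) (close-trans children (close-sym (close-add parent parent)))))
    where
    open +-*-Solver
    P P₀ P₁ : ℕ
    P = precision k (encStr σ)
    P₀ = precision k (encStr (σ ∷ʳ false))
    P₁ = precision k (encStr (σ ∷ʳ true))
    right : Close (ε k) (W P₀ (σ ∷ʳ true)) (W P₁ (σ ∷ʳ true))
    right = W-cauchy (σ ∷ʳ true) k P₀ P₁
              (subst (λ n → k ℕ.+ 3 ℕ.* n ℕ.≤ P₀) (length-sibling σ) (precision-bound k (σ ∷ʳ false)))
              (precision-mono {k} {k} (encStr (σ ∷ʳ false)) (encStr (σ ∷ʳ true)) ℕP.≤-refl (encStr-sibling≤ σ))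
    children : Close (ε k) (W P₀ (σ ∷ʳ false) + W P₁ (σ ∷ʳ true)) (W P₀ σ + W P₀ σ)
    children = close-resp ≃-refl (W-martingale P₀ σ) (close-addˡ (W P₀ (σ ∷ʳ false)) (close-sym right))
    parent : Close (ε k) (W P σ) (W P₀ σ)
    parent = W-cauchy σ k P P₀ (precision-bound k σ) (precision-mono {k} {k} (encStr σ) (encStr (σ ∷ʳ false)) ℕP.≤-refl (encStr-parent≤ σ))
    twice : ∀ w → w + w ≃ (1ℚᵘ + 1ℚᵘ) * w
    twice = solve 1 (λ w → w :+ w := (con 1ℚᵘ :+ con 1ℚᵘ) :* w) ≃-refl
    budget : ε k + (ε k + ε k) ≤ mkℚᵘ (+ 4) 0 * ε k
    budget = ≤-respʳ-≃ (≃-sym (four-copies (ε k))) (+-mono-≤ (≤-plusˡ {ε k} {ε k} (ε-nonneg k)) (≤-refl {ε k + ε k}))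

  isMartingale : IsMartingaleCode (repairedCode h)
  isMartingale = fastCauchy , nonneg , martingale

  -- If h codes a martingale, the repaired code codes the same one: its k-th approximation is
  -- within ε k of h's approximation at its precision P, which is within ε k of h's k-th.
  same : IsMartingaleCode h → SameMartingale (repairedCode h) h
  same h-martingale σ k =
    subst (λ a → ∣ a - approx h σ k ∣ ≤ mkℚᵘ (+ 2) 0 * ε k) (sym (approx-output σ k))
      (close⇒abs (close-mono (≤-reflexive (≃-sym (two-copies (ε k)))) (close-trans agreement cauchy)))
    where
    open Agreement h h-martingale
    open +-*-Solver
    P : ℕ
    P = precision k (encStr σ)
    agreement : Close (ε k) (W P σ) (approx h σ P)
    agreement = W-agrees σ k P (precision-bound⁺ k σ)
    cauchy : Close (ε k) (approx h σ P) (approx h σ k)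
    cauchy = abs⇒close (proj₁ h-martingale σ k P (ℕP.≤-trans (ℕP.m≤m+n k _) (ℕP.m≤m+n _ 5)))
    two-copies : ∀ x → mkℚᵘ (+ 2) 0 * x ≃ x + x
    two-copies = solve 1 (λ x → con (mkℚᵘ (+ 2) 0) :* x := x :+ x) ≃-refl

lemma6p2 : (A : Cantor) (g : Baire) → IsMartingaleCode g → TTReducible g A →
    (f : Baire) → TTReducible f A →
    Σ (Cantor → Baire) λ Φ → Σ (Cantor → Baire) λ Ψ →
      UniformMartingaleTest Φ × TotalComputable Ψ ×
      SameMartingale (Φ A) g × (∀ n → Ψ A n ≡ f n)
lemma6p2 A g g-martingale (Φg , Φg-computable , Φg≡g) f (Φf , Φf-computable , Φf≡f) =
  Φ , Φf , (Φ-computable , Φ-martingale) , Φf-computable , Φ-same , Φf≡f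
  where
  Φ : Cantor → Baire
  Φ X = repairedCode (Φg X)

  Φ-computable : TotalComputable Φ
  Φ-computable = Uniformity.repairedCodeᶜ Φg (total⇒computable Φg-computable)

  Φ-martingale : ∀ X → IsMartingaleCode (Φ X)
  Φ-martingale X = Output.isMartingale (Φg X)

  -- At A the would-be code is g, up to pointwise equality.
  Φ-same : SameMartingale (Φ A) g
  Φ-same = sameMartingale-resp {Φ A} Φg≡g (Output.same (Φg A) (isMartingaleCode-resp (λ n → sym (Φg≡g n)) g-martingale))
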